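{- Let $W$ be a string of length $n$ over an alphabet $\Sigma$, let $0<k<n$, and let $C$ be the array described in the context. Given $k$ and $C$, the algorithm TFS-ALGO constructs the shortest string $X$ such that the following hold: (I) no $W[i\mathinner{.\,.} i+k-1]$ with $C[i]=1$ occurs in $X$; (II) $\mathcal{I}_W\equiv\mathcal{I}_X$, i.e. the order of the substrings $W[i\mathinner{.\,.} i+k-1]$ for all $i$ with $C[i]=0$ is the same in $W$ and in $X$; conversely, the order of all substrings $U\in\Sigma^k$ of $X$ is the same in $X$ and in $W$; (III) $\text{Freq}_X(U)=\text{Freq}_W(U)$ for all $U\in\Sigma^k\setminus\{W[i\mathinner{.\,.} i+k-1]: C[i]=1\}$; (IV) the number of occurrences of the letter $\#$ in $X$ is at most $\lfloor\frac{n-k+1}{2}\rfloor$, and any two occurrences of $\#$ in $X$ are at least $k$ positions apart; (V) $0\le|X|\le\lceil\frac{n-k+1}{2}\rceil\cdot k+\lfloor\frac{n-k+1}{2}\rfloor$, and both bounds are tight (attained for some inputs).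
   Context: Strings are 0-indexed; $T[i\mathinner{.\,.} j]=T[i]\cdots T[j]$; $\text{Freq}_V(U)$ is the number of occurrences of $U$ in $V$; $\Sigma^k$ is the set of length-$k$ strings over $\Sigma$; $\#\notin\Sigma$. $\mathcal{S}\subseteq\{0,\ldots,n-k\}$ is a set of sensitive positions, closed under: if $i\in\mathcal{S}$ and $W[j\mathinner{.\,.} j+k-1]=W[i\mathinner{.\,.} i+k-1]$ then $j\in\mathcal{S}$; sensitive patterns are $W[i\mathinner{.\,.} i+k-1]$, $i\in\mathcal{S}$. The array $C$ has size $n$: $C[i]=1$ if $i\in\mathcal{S}$, $C[i]=0$ if $i\in\{0,\ldots,n-k\}\setminus\mathcal{S}$, and $C[n-k+1]=\cdots=C[n-1]=C[n-k]$. For a string $U$ over $\Sigma\cup\{\#\}$, $\mathcal{I}_U$ is the set of positions $j$ with $U[j\mathinner{.\,.} j+k-1]\in\Sigma^k$ not a sensitive pattern; $\mathcal{I}_U\equiv\mathcal{I}_V$ means $|\mathcal{I}_U|=|\mathcal{I}_V|$ and for all $j$ the length-$k$ substrings starting at the $j$-th smallest elements of $\mathcal{I}_U$ and $\mathcal{I}_V$ are equal. TFS-ALGO: set $X=\varepsilon$. If some $i$ has $C[i]=0$, let $j_0$ be the smallest such, set $X=W[j_0\mathinner{.\,.} j_0+k-1]$ and $j=j_0+k$; otherwise set $j=n$. While $j<n$: let $p=j-k$, $c=p+1$; if $C[p]=C[c]=0$, append $W[j]$ to $X$; if $C[p]=0,C[c]=1$, set $f=c$; if $C[p]=C[c]=1$,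 do nothing; if $C[p]=1,C[c]=0$: if $W[c\mathinner{.\,.} c+k-2]=W[f\mathinner{.\,.} f+k-2]$ append $W[j]$ to $X$, otherwise append $\#$ followed by $W[c\mathinner{.\,.} j]$; then increment $j$. Output $X$. -}

module Defs where

open import Data.Bool using (Bool; true; false; _∧_; not; if_then_else_)
open import Data.Nat using (ℕ; zero; suc; _+_; _*_; _∸_; _≤_; _<_; _⊓_; _≤?_; ⌊_/2⌋; ⌈_/2⌉)
open import Data.List using (List; []; _∷_; _++_; map; take; drop; length; filterᵇ; upTo)
open import Data.Bool.ListAction using (any)
open import Data.Maybe using (Maybe; just; nothing; is-just; is-nothing)
open import Data.Product using (_×_; ∃)
open import Relation.Binary.PropositionalEquality using (_≡_; _≢_)
open import Relation.Binary.Definitions using (DecidableEquality)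
open import Relation.Nullary using (¬_; does)
import Data.Nat as N
import Data.List.Properties as LP
import Data.Maybe.Properties as MP

-- Strings are lists; strings over Σ ∪ {#} are lists of Maybe A, with
-- nothing playing the role of the letter #.

window : {B : Set} → List B → ℕ → ℕ → List B
window U i len = take len (drop i U)

at : {B : Set} → List B → ℕ → Maybe B
at U i with drop i U
... | []    = nothing
... | x ∷ _ = just x

Occurs : {B : Set} → List B → List B → Set
Occurs P U = ∃ λ j → (j + length P ≤ length U) × (window U j (length P) ≡ P)

countHash : {A : Set} → List (Maybe A) → ℕ
countHash X = length (filterᵇ is-nothing X)

allJust : {A : Set} → List (Maybe A) → Maybe (List A)
allJust [] = just []
allJust (nothing ∷ _) = nothing
allJust (just a ∷ xs) with allJust xs
... | nothing = nothing
... | just ys = just (a ∷ ys)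

ValidS : {A : Set} → List A → ℕ → (ℕ → Bool) → Set
ValidS W k S =
  (∀ i → S i ≡ true → i + k ≤ length W) ×
  (∀ i j → S i ≡ true → j + k ≤ length W → window W j k ≡ window W i k → S j ≡ true)

-- the array C of size n = |W| (only indices < n are meaningful):
-- C[i] = [i ∈ S] for i ≤ n-k, and C[i] = C[n-k] for i > n-k
Carray : {A : Set} → List A → ℕ → (ℕ → Bool) → ℕ → Bool
Carray W k S i = S (i ⊓ (length W ∸ k))

CondI : {A : Set} → List A → ℕ → (ℕ → Bool) → List (Maybe A) → Set
CondI W k C Y = ∀ i → i + k ≤ length W → C i ≡ true → ¬ Occurs (map just (window W i k)) Y

CondIV : {A : Set} → List A → ℕ → List (Maybe A) → Set
CondIV W k Y =
  (countHash Y ≤ ⌊ (length W ∸ k + 1) /2⌋) ×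
  (∀ i j → i < j → at Y i ≡ just nothing → at Y j ≡ just nothing → i + k ≤ j)

bound : ℕ → ℕ → ℕ
bound n k = ⌈ (n ∸ k + 1) /2⌉ * k + ⌊ (n ∸ k + 1) /2⌋

module _ {A : Set} (_≟_ : DecidableEquality A) where

  _≟L_ : DecidableEquality (List A)
  _≟L_ = LP.≡-dec _≟_

  _≟LM_ : DecidableEquality (List (Maybe A))
  _≟LM_ = LP.≡-dec (MP.≡-dec _≟_)

  Freq : List (Maybe A) → List (Maybe A) → ℕ
  Freq V U = length (filterᵇ
    (λ j → does (j + length U ≤? length V) ∧ does (window V j (length U) ≟LM U))
    (upTo (suc (length V))))

  isSens : List A → ℕ → (ℕ → Bool) → List (Maybe A) → Bool
  isSens W k S V = any
    (λ i → S i ∧ does (i + k ≤? length W) ∧ does (map just (window W i k) ≟LM V))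
    (upTo (suc (length W)))

  inI : List A → ℕ → (ℕ → Bool) → List (Maybe A) → ℕ → Bool
  inI W k S U j =
    does (length (window U j k) N.≟ k) ∧ is-just (allJust (window U j k))
      ∧ not (isSens W k S (window U j k))

  Iset : List A → ℕ → (ℕ → Bool) → List (Maybe A) → List ℕ
  Iset W k S U = filterᵇ (inI W k S U) (upTo (length U))

  IEquiv : List A → ℕ → (ℕ → Bool) → List (Maybe A) → List (Maybe A) → Set
  IEquiv W k S U V =
    map (λ j → window U j k) (Iset W k S U) ≡ map (λ j → window V j k) (Iset W k S V)

  module Algo (W : List A) (k : ℕ) (C : ℕ → Bool) where

    n : ℕ
    n = length W

    findZero : ℕ → ℕ → Maybe ℕ
    findZero zero s = nothing
    findZero (suc t) s with C s
    ... | false = just s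
    ... | true  = findZero t (suc s)

    -- main loop; first argument is fuel (= number of remaining iterations n - j)
    loop : ℕ → ℕ → ℕ → List (Maybe A) → List (Maybe A)
    loop zero j f X = X
    loop (suc t) j f X = go (C p) (C c)
      where
        p = j ∸ k
        c = suc p
        go : Bool → Bool → List (Maybe A)
        go false false = loop t (suc j) f (X ++ map just (window W j 1))
        go false true  = loop t (suc j) c X
        go true  true  = loop t (suc j) f X
        go true  false = loop t (suc j) f
          (if does (window W c (k ∸ 1) ≟L window W f (k ∸ 1))
             then X ++ map just (window W j 1)
             else X ++ (nothing ∷ map just (window W c (suc (j ∸ c)))))

    start : Maybe ℕ → List (Maybe A)
    start nothing   = []
    start (just j₀) = loop (n ∸ (j₀ + k)) (j₀ + k) 0 (map just (window W j₀ k))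

    output : List (Maybe A)
    output = start (findZero n 0)

  tfs : List A → ℕ → (ℕ → Bool) → List (Maybe A)
  tfs W k C = Algo.output W k C

  CondII : List A → ℕ → (ℕ → Bool) → List (Maybe A) → Set
  CondII W k S Y = IEquiv W k S (map just W) Y

  CondIII : List A → ℕ → (ℕ → Bool) → List (Maybe A) → Set
  CondIII W k C Y = ∀ (U : List A) → length U ≡ k →
    (∀ i → i + k ≤ length W → C i ≡ true → window W i k ≢ U) →
    Freq Y (map just U) ≡ Freq (map just W) (map just U)

module Submission where

-- Let w₁, …, w_r be the non-sensitive k-mers of W in order. TFS-ALGO writes w₁ and then, for
-- each wᵢ₊₁, either its last letter (when it overlaps wᵢ in k - 1 letters) or # followed by
-- wᵢ₊₁. Hence the k-mers over Σ of the output X are exactly w₁, …, w_r, which gives (I)-(III),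
-- and |X| = k + Σᵢ (1 or k + 1). If Y satisfies (I) and (II), its k-mers over Σ are w₁, …, w_r
-- as well, and two consecutive ones start either 1 or at least k + 1 positions apart (at a
-- distance 2, …, k the window one position after the first would also be a k-mer), so
-- |Y| ≥ |X|. A # is written only where a run of sensitive positions ends, at most every other
-- step, which bounds both the number of # and |X|; on W = 0, 1, …, n - 1 the array C ≡ 1, the
-- array C ≡ 0 with k = 1 and an alternating C with k ≥ 2 attain the bounds.

open import Defs
open import Data.Bool using (Bool; true; false; T; _∧_; not; if_then_else_)
open import Data.Bool.Properties
  using (∧-zeroʳ; ∧-assoc; ∧-identityʳ; ∧-conicalˡ; ∧-conicalʳ; not-involutive; not-injective; ∨-zeroʳ; T-≡)
open import Data.Bool.ListAction using (any; all)
open import Data.Empty using (⊥-elim)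
open import Data.List using (List; []; _∷_; _++_; _∷ʳ_; map; take; drop; length; filterᵇ; upTo; applyUpTo)
open import Data.List.Membership.Propositional using (_∈_)
open import Data.List.Membership.Propositional.Properties using (∈-map⁻; ∈-upTo⁺; ∈-filter⁺; ∈-filter⁻)
open import Data.List.Relation.Unary.Any using (here; there)
import Data.List.Properties as Listₚ
import Data.Maybe.Properties as Maybe
open import Data.Maybe using (Maybe; just; nothing; is-just; is-nothing)
open import Data.Maybe.Properties using (just-injective)
open import Data.Nat using (ℕ; zero; suc; _+_; _*_; _∸_; _≤_; _<_; _⊓_; _≤?_; _<?_; z≤n; s≤s; ⌊_/2⌋; ⌈_/2⌉)
open import Data.Nat.Properties
open import Data.Product using (_×_; _,_; ∃; proj₁; proj₂; map₂)
open import Data.Sum using (_⊎_; inj₁; inj₂)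
open import Function using (_∘_)
open import Function.Bundles using (Equivalence)
open import Relation.Binary.PropositionalEquality
open import Relation.Binary.Definitions using (DecidableEquality)
open import Relation.Nullary using (Dec; yes; no; does)
open import Relation.Nullary.Decidable using (dec-true; dec-false; T?)

does-true : ∀ {P : Set} (d : Dec P) → does d ≡ true → P
does-true (yes p) _ = p

filterᵇ-accept : ∀ {B : Set} (p : B → Bool) {x} xs → p x ≡ true → filterᵇ p (x ∷ xs) ≡ x ∷ filterᵇ p xs
filterᵇ-accept p xs e = Listₚ.filter-accept (T? ∘ p) (Equivalence.from T-≡ e)

filterᵇ-reject : ∀ {B : Set} (p : B → Bool) {x} xs → p x ≡ false → filterᵇ p (x ∷ xs) ≡ filterᵇ p xs
filterᵇ-reject p xs e = Listₚ.filter-reject (T? ∘ p) (subst T e)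

filterᵇ-++ : ∀ {B : Set} (p : B → Bool) xs ys → filterᵇ p (xs ++ ys) ≡ filterᵇ p xs ++ filterᵇ p ys
filterᵇ-++ p = Listₚ.filter-++ (T? ∘ p)

∈-filterᵇ⁺ : ∀ {B : Set} (p : B → Bool) {x xs} → x ∈ xs → p x ≡ true → x ∈ filterᵇ p xs
∈-filterᵇ⁺ p x∈xs e = ∈-filter⁺ (T? ∘ p) x∈xs (Equivalence.from T-≡ e)

∈-filterᵇ⁻ : ∀ {B : Set} (p : B → Bool) {x xs} → x ∈ filterᵇ p xs → x ∈ xs × p x ≡ true
∈-filterᵇ⁻ p x∈ = map₂ (Equivalence.to T-≡) (∈-filter⁻ (T? ∘ p) x∈)

filterᵇ-cong : ∀ {B : Set} (p q : B → Bool) xs → (∀ x → x ∈ xs → p x ≡ q x) → filterᵇ p xs ≡ filterᵇ q xs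
filterᵇ-cong p q [] _ = refl
filterᵇ-cong p q (x ∷ xs) h with p x | q x | h x (here refl)
... | true  | true  | _ = cong (x ∷_) (filterᵇ-cong p q xs (λ y → h y ∘ there))
... | false | false | _ = filterᵇ-cong p q xs (λ y → h y ∘ there)

filterᵇ-all : ∀ {B : Set} (p : B → Bool) xs → (∀ x → x ∈ xs → p x ≡ true) → filterᵇ p xs ≡ xs
filterᵇ-all p [] _ = refl
filterᵇ-all p (x ∷ xs) h =
  trans (filterᵇ-accept p xs (h x (here refl))) (cong (x ∷_) (filterᵇ-all p xs (λ y → h y ∘ there)))

filterᵇ-∷ : ∀ {B : Set} (p : B → Bool) x xs →
  filterᵇ p (x ∷ xs) ≡ (if p x then x ∷ filterᵇ p xs else filterᵇ p xs)
filterᵇ-∷ p x xs with p x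
... | true  = refl
... | false = refl

filterᵇ-∧ : ∀ {B : Set} (p q : B → Bool) xs → filterᵇ (λ x → p x ∧ q x) xs ≡ filterᵇ q (filterᵇ p xs)
filterᵇ-∧ p q [] = refl
filterᵇ-∧ p q (x ∷ xs) rewrite filterᵇ-∷ (λ x → p x ∧ q x) x xs | filterᵇ-∷ p x xs with p x
... | false = filterᵇ-∧ p q xs
... | true rewrite filterᵇ-∷ q x (filterᵇ p xs) with q x
...   | true  = cong (x ∷_) (filterᵇ-∧ p q xs)
...   | false = filterᵇ-∧ p q xs

filterᵇ-refine : ∀ {B : Set} (p q : B → Bool) xs → (∀ x → x ∈ xs → p x ≡ true → q x ≡ true) →
  filterᵇ p xs ≡ filterᵇ p (filterᵇ q xs)
filterᵇ-refine p q xs h = trans (filterᵇ-cong p (λ x → q x ∧ p x) xs pq) (filterᵇ-∧ q p xs)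
  where
  pq : ∀ x → x ∈ xs → p x ≡ q x ∧ p x
  pq x x∈ with p x in px
  ... | true  = sym (trans (∧-identityʳ (q x)) (h x x∈ px))
  ... | false = sym (∧-zeroʳ (q x))

map-filterᵇ : ∀ {B D : Set} (g : B → D) (p : D → Bool) xs →
  map g (filterᵇ (p ∘ g) xs) ≡ filterᵇ p (map g xs)
map-filterᵇ g p [] = refl
map-filterᵇ g p (x ∷ xs) with p (g x)
... | true  = cong (g x ∷_) (map-filterᵇ g p xs)
... | false = map-filterᵇ g p xs

any-true⁺ : ∀ {B : Set} (p : B → Bool) {x} xs → x ∈ xs → p x ≡ true → any p xs ≡ true
any-true⁺ p (y ∷ xs) (here refl) e rewrite e = refl
any-true⁺ p (y ∷ xs) (there x∈) e rewrite any-true⁺ p xs x∈ e = ∨-zeroʳ (p y)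

any-true⁻ : ∀ {B : Set} (p : B → Bool) xs → any p xs ≡ true → ∃ λ x → p x ≡ true
any-true⁻ p (y ∷ xs) e with p y in py
... | true  = y , py
... | false = any-true⁻ p xs e

take-++-≤ : ∀ {B : Set} n (xs ys : List B) → n ≤ length xs → take n (xs ++ ys) ≡ take n xs
take-++-≤ zero xs ys _ = refl
take-++-≤ (suc n) (x ∷ xs) ys (s≤s le) = cong (x ∷_) (take-++-≤ n xs ys le)

take-+ : ∀ {B : Set} a b (xs : List B) → take a xs ++ take b (drop a xs) ≡ take (a + b) xs
take-+ zero b xs = refl
take-+ (suc a) b [] = Listₚ.take-[] b
take-+ (suc a) b (x ∷ xs) = cong (x ∷_) (take-+ a b xs)

drop-1-take : ∀ {B : Set} k (xs : List B) → drop 1 (take k xs) ≡ take (k ∸ 1) (drop 1 xs)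
drop-1-take zero xs = refl
drop-1-take (suc k) [] = sym (Listₚ.take-[] k)
drop-1-take (suc k) (x ∷ xs) = refl

drop-1-drop : ∀ {B : Set} c (xs : List B) → drop 1 (drop c xs) ≡ drop (suc c) xs
drop-1-drop c xs = trans (Listₚ.drop-drop c 1 xs) (cong (λ r → drop r xs) (+-comm c 1))

length-take-≤ : ∀ {B : Set} k (xs : List B) → k ≤ length xs → length (take k xs) ≡ k
length-take-≤ k xs le = trans (Listₚ.length-take k xs) (m≤n⇒m⊓n≡m le)

window-length : ∀ {B : Set} (V : List B) i k → i + k ≤ length V → length (window V i k) ≡ k
window-length V i k le =
  length-take-≤ k (drop i V) (subst (k ≤_) (sym (Listₚ.length-drop i V)) (m+n≤o⇒m≤o∸n k (subst (_≤ length V) (+-comm i k) le)))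

window-length⇒bound : ∀ {B : Set} (V : List B) j k → 0 < k → length (window V j k) ≡ k → j + k ≤ length V
window-length⇒bound V j k 0<k e =
  subst (_≤ length V) (+-comm k j) (m≤o∸n⇒m+n≤o k j≤V (subst (k ≤_) (Listₚ.length-drop j V) k≤))
  where
  k≤ : k ≤ length (drop j V)
  k≤ = m⊓n≡m⇒m≤n (trans (sym (Listₚ.length-take k (drop j V))) e)
  j≤V : j ≤ length V
  j≤V with j ≤? length V
  ... | yes le = le
  ... | no  gt = ⊥-elim (<-irrefl refl (<-≤-trans 0<k (subst (k ≤_) (cong length (Listₚ.drop-all j V (<⇒≤ (≰⇒> gt)))) k≤)))

windows : {B : Set} → ℕ → List B → List (List B)
windows k [] = []
windows k (y ∷ Y) = take k (y ∷ Y) ∷ windows k Y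

map-window-upTo : ∀ {B : Set} k (Y : List B) → map (λ j → window Y j k) (upTo (length Y)) ≡ windows k Y
map-window-upTo k Y = trans (Listₚ.map-upTo (λ j → window Y j k) (length Y)) (applyUpTo-window Y)
  where
  applyUpTo-window : ∀ Y → applyUpTo (λ j → window Y j k) (length Y) ≡ windows k Y
  applyUpTo-window [] = refl
  applyUpTo-window (y ∷ Y) = cong (take k (y ∷ Y) ∷_) (applyUpTo-window Y)

window-∈-windows : ∀ {B : Set} k j (Y : List B) → j < length Y → window Y j k ∈ windows k Y
window-∈-windows k zero (y ∷ Y) _ = here refl
window-∈-windows k (suc j) (y ∷ Y) (s≤s j<) = there (window-∈-windows k j Y j<)

∈-windows⁻ : ∀ {B : Set} k (Y : List B) {w} → w ∈ windows k Y → ∃ λ j → j < length Y × window Y j k ≡ w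
∈-windows⁻ k (y ∷ Y) (here e) = 0 , s≤s z≤n , sym e
∈-windows⁻ k (y ∷ Y) (there w∈) with ∈-windows⁻ k Y w∈
... | j , j< , e = suc j , s≤s j< , e

all-just-++ : {A : Set} (xs ys : List (Maybe A)) → all is-just (xs ++ ys) ≡ all is-just xs ∧ all is-just ys
all-just-++ [] ys = refl
all-just-++ (nothing ∷ xs) ys = refl
all-just-++ (just x ∷ xs) ys = all-just-++ xs ys

all-just-take : ∀ {A : Set} n (xs : List (Maybe A)) → all is-just xs ≡ true → all is-just (take n xs) ≡ true
all-just-take zero xs e = refl
all-just-take (suc n) [] e = refl
all-just-take (suc n) (just x ∷ xs) e = all-just-take n xs e

all-just-map-just : {A : Set} (v : List A) → all is-just (map just v) ≡ true
all-just-map-just [] = refl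
all-just-map-just (x ∷ v) = all-just-map-just v

is-just-allJust : {A : Set} (w : List (Maybe A)) → is-just (allJust w) ≡ all is-just w
is-just-allJust [] = refl
is-just-allJust (nothing ∷ w) = refl
is-just-allJust (just a ∷ w) with allJust w | is-just-allJust w
... | nothing | e = e
... | just _  | e = e

isKmer : {A : Set} → ℕ → List (Maybe A) → Bool
isKmer k w = does (length w ≟ k) ∧ is-just (allJust w)

kmers : {A : Set} → ℕ → List (Maybe A) → List (List (Maybe A))
kmers k Y = filterᵇ (isKmer k) (windows k Y)

module _ {A : Set} where

  isKmer-accept : ∀ k (w : List (Maybe A)) → length w ≡ k → all is-just w ≡ true → isKmer k w ≡ true
  isKmer-accept k w ℓ a rewrite is-just-allJust w | a | dec-true (length w ≟ k) ℓ = refl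

  isKmer-rejectLength : ∀ k (w : List (Maybe A)) → length w ≢ k → isKmer k w ≡ false
  isKmer-rejectLength k w ℓ rewrite dec-false (length w ≟ k) ℓ = refl

  isKmer-rejectHash : ∀ k (w : List (Maybe A)) → all is-just w ≡ false → isKmer k w ≡ false
  isKmer-rejectHash k w a rewrite is-just-allJust w | a = ∧-zeroʳ _

  isKmer⇒length : ∀ k (w : List (Maybe A)) → isKmer k w ≡ true → length w ≡ k
  isKmer⇒length k w e = does-true (length w ≟ k) (∧-conicalˡ _ _ e)

  isKmer⇒all-just : ∀ k (w : List (Maybe A)) → isKmer k w ≡ true → all is-just w ≡ true
  isKmer⇒all-just k w e = trans (sym (is-just-allJust w)) (∧-conicalʳ _ _ e)

  kmers-short : ∀ k (Y : List (Maybe A)) → length Y < k → kmers k Y ≡ []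
  kmers-short k [] _ = refl
  kmers-short k (y ∷ Y) Y<k =
    trans (filterᵇ-reject (isKmer k) {take k (y ∷ Y)} (windows k Y) (isKmer-rejectLength k (take k (y ∷ Y)) short))
          (kmers-short k Y (<-trans (n<1+n _) Y<k))
    where
    short : length (take k (y ∷ Y)) ≢ k
    short e = <-irrefl (sym (trans (sym e) (trans (Listₚ.length-take k (y ∷ Y)) (m≥n⇒m⊓n≡n (<⇒≤ Y<k))))) Y<k

  kmers-∷ : ∀ k (y : Maybe A) Y Y′ R → take k (y ∷ Y′) ≡ take k (y ∷ Y) →
    kmers k Y′ ≡ kmers k Y ++ R → kmers k (y ∷ Y′) ≡ kmers k (y ∷ Y) ++ R
  kmers-∷ k y Y Y′ R head tail rewrite head with isKmer k (take k (y ∷ Y))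
  ... | true  = cong (take k (y ∷ Y) ∷_) tail
  ... | false = tail

  all-just-take-# : ∀ n (xs ys : List (Maybe A)) → length xs < n → all is-just (take n (xs ++ nothing ∷ ys)) ≡ false
  all-just-take-# (suc n) [] ys _ = refl
  all-just-take-# (suc n) (nothing ∷ xs) ys _ = refl
  all-just-take-# (suc n) (just x ∷ xs) ys (s≤s xs<n) = all-just-take-# n xs ys xs<n

takeLast : {B : Set} → ℕ → List B → List B
takeLast m Y = drop (length Y ∸ m) Y

module _ {A : Set} where

  kmers-++ : ∀ m (Y Z : List (Maybe A)) →
    kmers (suc m) (Y ++ Z) ≡ kmers (suc m) Y ++ kmers (suc m) (takeLast m Y ++ Z)
  kmers-++ m [] Z rewrite 0∸n≡0 m = refl
  kmers-++ m (y ∷ Y) Z with m ≤? length Y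
  ... | yes m≤Y rewrite +-∸-assoc 1 m≤Y =
    kmers-∷ (suc m) y Y (Y ++ Z) _ (take-++-≤ (suc m) (y ∷ Y) Z (s≤s m≤Y)) (kmers-++ m Y Z)
  ... | no  m≰Y rewrite m≤n⇒m∸n≡0 (≰⇒> m≰Y) | kmers-short (suc m) (y ∷ Y) (s≤s (≰⇒> m≰Y)) = refl

  kmers-++-# : ∀ m (Y Z : List (Maybe A)) → kmers (suc m) (Y ++ nothing ∷ Z) ≡ kmers (suc m) Y ++ kmers (suc m) Z
  kmers-++-# m [] Z = filterᵇ-reject (isKmer (suc m)) {nothing ∷ take m Z} (windows (suc m) Z)
    (isKmer-rejectHash (suc m) (nothing ∷ take m Z) refl)
  kmers-++-# m (y ∷ Y) Z with suc m ≤? length (y ∷ Y)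
  ... | yes k≤ = kmers-∷ (suc m) y Y (Y ++ nothing ∷ Z) _ (take-++-≤ (suc m) (y ∷ Y) (nothing ∷ Z) k≤) (kmers-++-# m Y Z)
  ... | no  k≰ rewrite kmers-short (suc m) (y ∷ Y) (≰⇒> k≰) =
    trans (filterᵇ-reject (isKmer (suc m)) {take (suc m) (y ∷ Y ++ nothing ∷ Z)} (windows (suc m) (Y ++ nothing ∷ Z))
             (isKmer-rejectHash (suc m) (take (suc m) (y ∷ Y ++ nothing ∷ Z)) (all-just-take-# (suc m) (y ∷ Y) Z (≰⇒> k≰))))
    (trans (kmers-++-# m Y Z) (cong (_++ kmers (suc m) Z) (kmers-short (suc m) Y (<-trans (n<1+n _) (≰⇒> k≰)))))

  kmers-single : ∀ k (V : List (Maybe A)) → 0 < k → length V ≡ k → all is-just V ≡ true → kmers k V ≡ V ∷ []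
  kmers-single k [] 0<k ℓ _ = ⊥-elim (<-irrefl ℓ 0<k)
  kmers-single k (v ∷ V) _ ℓ a =
    trans (cong (λ h → filterᵇ (isKmer k) (h ∷ windows k V)) (Listₚ.take-all k (v ∷ V) (≤-reflexive ℓ)))
    (trans (filterᵇ-accept (isKmer k) (windows k V) (isKmer-accept k (v ∷ V) ℓ a))
    (cong ((v ∷ V) ∷_) (kmers-short k V (≤-reflexive ℓ))))

interval : ℕ → ℕ → List ℕ
interval s zero = []
interval s (suc t) = s ∷ interval (suc s) t

map-interval-suc : ∀ {B : Set} (g : ℕ → B) s t → map g (interval (suc s) t) ≡ map (g ∘ suc) (interval s t)
map-interval-suc g s zero = refl
map-interval-suc g s (suc t) = cong (g (suc s) ∷_) (map-interval-suc g (suc s) t)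

∈-interval⁻ : ∀ {q} s t → q ∈ interval s t → s ≤ q × q < s + t
∈-interval⁻ s (suc t) (here refl) = ≤-refl , subst (s <_) (sym (+-suc s t)) (s≤s (m≤m+n s t))
∈-interval⁻ {q} s (suc t) (there q∈) with ∈-interval⁻ (suc s) t q∈
... | s< , <s+t = <⇒≤ s< , subst (q <_) (sym (+-suc s t)) <s+t

kmers-map-just : ∀ {A : Set} m (V : List A) →
  kmers (suc m) (map just V) ≡ map (λ q → map just (window V q (suc m))) (interval 0 (length V ∸ m))
kmers-map-just m [] rewrite 0∸n≡0 m = refl
kmers-map-just m (x ∷ V) with m ≤? length V
... | yes m≤V = begin
  kmers (suc m) (just x ∷ map just V)
    ≡⟨ filterᵇ-accept (isKmer (suc m)) {take (suc m) (just x ∷ map just V)} (windows (suc m) (map just V))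
         (isKmer-accept (suc m) (take (suc m) (map just (x ∷ V))) (trans (Listₚ.length-take (suc m) (map just (x ∷ V)))
           (cong suc (m≤n⇒m⊓n≡m (subst (m ≤_) (sym (Listₚ.length-map just V)) m≤V))))
           (subst (λ w → all is-just w ≡ true) (sym (Listₚ.take-map {f = just} (suc m) (x ∷ V))) (all-just-map-just (take (suc m) (x ∷ V))))) ⟩
  take (suc m) (map just (x ∷ V)) ∷ kmers (suc m) (map just V)
    ≡⟨ cong₂ _∷_ (Listₚ.take-map {f = just} (suc m) (x ∷ V)) (kmers-map-just m V) ⟩
  g 0 ∷ map (g ∘ suc) (interval 0 (length V ∸ m))
    ≡⟨ cong (g 0 ∷_) (sym (map-interval-suc g 0 (length V ∸ m))) ⟩
  map g (interval 0 (suc (length V ∸ m)))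
    ≡⟨ cong (λ r → map g (interval 0 r)) (sym (+-∸-assoc 1 m≤V)) ⟩
  map g (interval 0 (length (x ∷ V) ∸ m)) ∎
  where
  open ≡-Reasoning
  g : ℕ → List (Maybe _)
  g q = map just (window (x ∷ V) q (suc m))
... | no  m≰V =
  trans (kmers-short (suc m) (map just (x ∷ V)) (subst (_< suc m) (sym (Listₚ.length-map just (x ∷ V))) (s≤s (≰⇒> m≰V))))
        (cong (λ r → map (λ q → map just (window (x ∷ V) q (suc m))) (interval 0 r)) (sym (m≤n⇒m∸n≡0 (≰⇒> m≰V))))

-- The length of the shortest string over Σ ∪ {#} whose k-mers over Σ are ws, in order:
-- k letters for the first k-mer, then one letter for a successor overlapping its
-- predecessor in k - 1 letters, and # followed by the whole successor otherwise.
module Spelling {B : Set} (_≟_ : DecidableEquality (List B)) (k : ℕ) where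

  joinCost : List B → List B → ℕ
  joinCost v w = if does (take (k ∸ 1) w ≟ drop 1 v) then 1 else suc k

  spellLengthAfter : List B → List (List B) → ℕ
  spellLengthAfter v [] = 0
  spellLengthAfter v (w ∷ ws) = joinCost v w + spellLengthAfter w ws

  spellLength : List (List B) → ℕ
  spellLength [] = 0
  spellLength (v ∷ ws) = k + spellLengthAfter v ws

  joinCost-overlap : ∀ v w → take (k ∸ 1) w ≡ drop 1 v → joinCost v w ≡ 1
  joinCost-overlap v w e rewrite dec-true (take (k ∸ 1) w ≟ drop 1 v) e = refl

  joinCost-≤ : ∀ v w → joinCost v w ≤ suc k
  joinCost-≤ v w with does (take (k ∸ 1) w ≟ drop 1 v)
  ... | true  = s≤s z≤n
  ... | false = ≤-refl

does-≡-dec-map-just : ∀ {A : Set} (_≟_ : DecidableEquality A) (v w : List A) →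
  does (Listₚ.≡-dec (Maybe.≡-dec _≟_) (map just v) (map just w)) ≡ does (Listₚ.≡-dec _≟_ v w)
does-≡-dec-map-just _≟_ v w with Listₚ.≡-dec _≟_ v w
... | yes e = dec-true (Listₚ.≡-dec (Maybe.≡-dec _≟_) _ _) (cong (map just) e)
... | no ¬e = dec-false (Listₚ.≡-dec (Maybe.≡-dec _≟_) _ _) (¬e ∘ Listₚ.map-injective just-injective)

spellLengthAfter-map-just : ∀ {A : Set} (_≟_ : DecidableEquality A) k v ws →
  Spelling.spellLengthAfter (Listₚ.≡-dec (Maybe.≡-dec _≟_)) k (map just v) (map (map just) ws)
    ≡ Spelling.spellLengthAfter (Listₚ.≡-dec _≟_) k v ws
spellLengthAfter-map-just _≟_ k v [] = refl
spellLengthAfter-map-just _≟_ k v (w ∷ ws)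
  rewrite Listₚ.take-map {f = just} (k ∸ 1) w | Listₚ.drop-map {f = just} 1 v
        | spellLengthAfter-map-just _≟_ k w ws =
  cong (λ b → (if b then 1 else suc k) + _) (does-≡-dec-map-just _≟_ (take (k ∸ 1) w) (drop 1 v))

spellLength-map-just : ∀ {A : Set} (_≟_ : DecidableEquality A) k ws →
  Spelling.spellLength (Listₚ.≡-dec (Maybe.≡-dec _≟_)) k (map (map just) ws) ≡ Spelling.spellLength (Listₚ.≡-dec _≟_) k ws
spellLength-map-just _≟_ k [] = refl
spellLength-map-just _≟_ k (v ∷ ws) = cong (k +_) (spellLengthAfter-map-just _≟_ k v ws)

module _ {A : Set} where

  offset : ℕ → List (Maybe A) → ℕ
  offset k [] = 0
  offset k (y ∷ Y) = if isKmer k (take k (y ∷ Y)) then 0 else suc (offset k Y)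

  kmers-head : ∀ k (Y : List (Maybe A)) {w rest} → kmers k Y ≡ w ∷ rest → w ≡ window Y (offset k Y) k
  kmers-head k (y ∷ Y) e with isKmer k (take k (y ∷ Y))
  ... | true  = sym (Listₚ.∷-injectiveˡ e)
  ... | false = kmers-head k Y e

  kmers-head-isKmer : ∀ k (Y : List (Maybe A)) {w rest} → kmers k Y ≡ w ∷ rest → isKmer k w ≡ true
  kmers-head-isKmer k Y {w} e = proj₂ (∈-filterᵇ⁻ (isKmer k) {w} {windows k Y} (subst (w ∈_) (sym e) (here refl)))

  offset-zero : ∀ k (Y : List (Maybe A)) → 0 < length Y → isKmer k (take k Y) ≡ true → offset k Y ≡ 0
  offset-zero k (y ∷ Y) _ isK rewrite isK = refl

  -- If letters 1 .. k - 1 of y ∷ Y lie in Σ, a k-mer starting in Y at offset a ∈ [1, k - 1]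
  -- would make the window at offset 0 of Y a k-mer as well.
  offset-after-kmer : ∀ m (y : Maybe A) Y {w rest} → isKmer (suc m) (take (suc m) (y ∷ Y)) ≡ true →
    kmers (suc m) Y ≡ w ∷ rest → offset (suc m) Y ≡ 0 ⊎ suc m ≤ offset (suc m) Y
  offset-after-kmer m y Y {w} isK e with offset (suc m) Y in a≡ | m <? offset (suc m) Y
  ... | zero  | _      = inj₁ refl
  ... | suc _ | yes m< = inj₂ m<
  ... | suc _ | no  m≮ = ⊥-elim (0≢1+n (trans (sym (offset-zero k Y (≤-trans (s≤s z≤n) k≤Y) kmerAt0)) a≡))
    where
    k = suc m
    a′ = offset k Y
    a′≤m : a′ ≤ m
    a′≤m = subst (_≤ m) (sym a≡) (≮⇒≥ m≮)
    w≡ : w ≡ take k (drop a′ Y)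
    w≡ = kmers-head k Y e
    isKw : isKmer k (take k (drop a′ Y)) ≡ true
    isKw = subst (λ z → isKmer k z ≡ true) w≡ (kmers-head-isKmer k Y e)
    k≤Y : k ≤ length Y
    k≤Y = ≤-trans (m⊓n≡m⇒m≤n (trans (sym (Listₚ.length-take k (drop a′ Y))) (isKmer⇒length k (take k (drop a′ Y)) isKw)))
                  (subst (_≤ length Y) (sym (Listₚ.length-drop a′ Y)) (m∸n≤m (length Y) a′))
    before : all is-just (take a′ Y) ≡ true
    before = subst (λ z → all is-just z ≡ true) (trans (Listₚ.take-take a′ m Y) (cong (λ r → take r Y) (m≤n⇒m⊓n≡m a′≤m)))
               (all-just-take a′ (take m Y) (∧-conicalʳ (is-just y) _ (isKmer⇒all-just k (take k (y ∷ Y)) isK)))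
    from : all is-just (take (k ∸ a′) (drop a′ Y)) ≡ true
    from = subst (λ z → all is-just z ≡ true)
             (trans (Listₚ.take-take (k ∸ a′) k (drop a′ Y)) (cong (λ r → take r (drop a′ Y)) (m≤n⇒m⊓n≡m (m∸n≤m k a′))))
             (all-just-take (k ∸ a′) _ (isKmer⇒all-just k (take k (drop a′ Y)) isKw))
    kmerAt0 : isKmer k (take k Y) ≡ true
    kmerAt0 = isKmer-accept k (take k Y) (length-take-≤ k Y k≤Y)
      (subst (λ z → all is-just z ≡ true) (trans (take-+ a′ (k ∸ a′) Y) (cong (λ r → take r Y) (m+[n∸m]≡n (m≤n⇒m≤1+n a′≤m))))
        (trans (all-just-++ (take a′ Y) _) (cong₂ _∧_ before from)))

  spellLength-kmers-≤ : ∀ (_≟_ : DecidableEquality (List (Maybe A))) m (Y : List (Maybe A)) →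
    offset (suc m) Y + Spelling.spellLength _≟_ (suc m) (kmers (suc m) Y) ≤ length Y
  spellLength-kmers-≤ _≟_ m [] = z≤n
  spellLength-kmers-≤ _≟_ m (y ∷ Y) with isKmer (suc m) (take (suc m) (y ∷ Y)) in isK
  ... | false = s≤s (spellLength-kmers-≤ _≟_ m Y)
  ... | true  = extend (kmers (suc m) Y) refl (spellLength-kmers-≤ _≟_ m Y)
    where
    open Spelling _≟_ (suc m)
    open ≤-Reasoning
    k = suc m
    h = take k (y ∷ Y)
    extend : ∀ ws → kmers k Y ≡ ws → offset k Y + spellLength ws ≤ length Y → spellLength (h ∷ ws) ≤ suc (length Y)
    extend [] _ _ = subst (_≤ suc (length Y)) (trans (isKmer⇒length k h isK) (sym (+-identityʳ k)))
                      (≤-trans (≤-reflexive (Listₚ.length-take k (y ∷ Y))) (m⊓n≤n k (suc (length Y))))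
    extend (w ∷ ws) e ih with offset-after-kmer m y Y isK e
    ... | inj₁ off≡0 = begin
      k + (joinCost h w + spellLengthAfter w ws) ≡⟨ cong (λ c → k + (c + spellLengthAfter w ws)) (joinCost-overlap h w shifted) ⟩
      k + suc (spellLengthAfter w ws)            ≡⟨ +-suc k _ ⟩
      suc (k + spellLengthAfter w ws)            ≤⟨ s≤s (subst (λ o → o + spellLength (w ∷ ws) ≤ length Y) off≡0 ih) ⟩
      suc (length Y)                             ∎
      where
      shifted : take m w ≡ drop 1 h
      shifted = trans (cong (take m) (trans (kmers-head k Y e) (cong (λ o → window Y o k) off≡0)))
                (trans (Listₚ.take-take m k Y) (cong (λ r → take r Y) (m≤n⇒m⊓n≡m (n≤1+n m))))
    ... | inj₂ k≤off = begin
      k + (joinCost h w + spellLengthAfter w ws) ≤⟨ +-monoʳ-≤ k (+-monoˡ-≤ _ (joinCost-≤ h w)) ⟩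
      k + (suc k + spellLengthAfter w ws)         ≡⟨ +-suc k _ ⟩
      suc (k + (k + spellLengthAfter w ws))       ≤⟨ s≤s (+-monoˡ-≤ _ k≤off) ⟩
      suc (offset k Y + spellLength (w ∷ ws))     ≤⟨ s≤s ih ⟩
      suc (length Y)                              ∎

countHash-++ : ∀ {A : Set} (xs ys : List (Maybe A)) → countHash (xs ++ ys) ≡ countHash xs + countHash ys
countHash-++ xs ys = trans (cong length (filterᵇ-++ is-nothing xs ys)) (Listₚ.length-++ (filterᵇ is-nothing xs))

countHash-map-just : ∀ {A : Set} (v : List A) → countHash (map just v) ≡ 0
countHash-map-just [] = refl
countHash-map-just (x ∷ v) = countHash-map-just v

data Spaced {A : Set} (k : ℕ) : List (Maybe A) → Set where
  []     : Spaced k []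
  letter : ∀ a {Y} → Spaced k Y → Spaced k (just a ∷ Y)
  hash   : ∀ v {Y} → length v ≡ k → Spaced k Y → Spaced k (nothing ∷ (map just v ++ Y))

module _ {A : Set} where

  spaced-map-just : ∀ {k} v {Y : List (Maybe A)} → Spaced k Y → Spaced k (map just v ++ Y)
  spaced-map-just [] s = s
  spaced-map-just (a ∷ v) s = letter a (spaced-map-just v s)

  at-map-just-< : ∀ (v : List A) Y e → e < length v → at (map just v ++ Y) e ≢ just nothing
  at-map-just-< (a ∷ v) Y zero _ ()
  at-map-just-< (a ∷ v) Y (suc e) (s≤s e<) = at-map-just-< v Y e e<

  at-map-just-+ : ∀ (v : List A) Y e → at (map just v ++ Y) (length v + e) ≡ at Y e
  at-map-just-+ [] Y e = refl
  at-map-just-+ (a ∷ v) Y e = at-map-just-+ v Y e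

  at-map-just-# : ∀ (v : List A) Y e → at (map just v ++ Y) e ≡ just nothing →
    ∃ λ e′ → e ≡ length v + e′ × at Y e′ ≡ just nothing
  at-map-just-# v Y e #e with length v ≤? e
  ... | yes v≤e = e ∸ length v , sym (m+[n∸m]≡n v≤e) ,
                  trans (sym (at-map-just-+ v Y (e ∸ length v))) (trans (cong (at (map just v ++ Y)) (m+[n∸m]≡n v≤e)) #e)
  ... | no  v≰e = ⊥-elim (at-map-just-< v Y e (≰⇒> v≰e) #e)

  spaced⇒hashes-apart : ∀ {k} {Y : List (Maybe A)} → Spaced k Y →
    ∀ i j → i < j → at Y i ≡ just nothing → at Y j ≡ just nothing → i + k ≤ j
  spaced⇒hashes-apart (letter a s) (suc i) (suc j) (s≤s i<j) #i #j = s≤s (spaced⇒hashes-apart s i j i<j #i #j)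
  spaced⇒hashes-apart (hash v {Y} ℓ s) zero (suc j) _ _ #j with at-map-just-# v Y j #j
  ... | e′ , refl , _ = ≤-trans (subst (_≤ length v + e′) ℓ (m≤m+n (length v) e′)) (n≤1+n _)
  spaced⇒hashes-apart {k} (hash v {Y} ℓ s) (suc i) (suc j) (s≤s i<j) #i #j
    with at-map-just-# v Y i #i | at-map-just-# v Y j #j
  ... | i′ , refl , #i′ | j′ , refl , #j′ =
    s≤s (subst (_≤ length v + j′) (sym (+-assoc (length v) i′ k))
          (+-monoʳ-≤ (length v) (spaced⇒hashes-apart s i′ j′ (+-cancelˡ-< (length v) i′ j′ i<j) #i′ #j′)))

module Run {A : Set} (_≟A_ : DecidableEquality A) (W : List A) (m : ℕ) (C : ℕ → Bool) where

  k n : ℕ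
  k = suc m
  n = length W

  open Algo _≟A_ W k C using (loop; findZero; start; output)

  letterAt : ℕ → List (Maybe A)
  letterAt p = map just (window W (p + k) 1)

  restart : ℕ → List (Maybe A)
  restart p = nothing ∷ map just (window W (suc p) k)

  continues : ℕ → ℕ → Bool
  continues p f = does (_≟L_ _≟A_ (window W (suc p) m) (window W f m))

  rejoin : ℕ → ℕ → List (Maybe A)
  rejoin p f = if continues p f then letterAt p else restart p

  -- the loop of TFS-ALGO indexed by p = j - k instead of j
  run : ℕ → ℕ → ℕ → List (Maybe A) → List (Maybe A)
  run zero p f X = X
  run (suc t) p f X with C p | C (suc p)
  ... | false | false = run t (suc p) f (X ++ letterAt p)
  ... | false | true  = run t (suc p) (suc p) X
  ... | true  | true  = run t (suc p) f X
  ... | true  | false = run t (suc p) f (X ++ rejoin p f)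

  suc[p+k∸suc-p]≡k : ∀ p → suc (p + k ∸ suc p) ≡ k
  suc[p+k∸suc-p]≡k p = cong suc (trans (cong (_∸ suc p) (+-suc p m)) (m+n∸m≡n p m))

  loop≡run : ∀ t p f X → loop t (p + k) f X ≡ run t p f X
  loop≡run zero p f X = refl
  loop≡run (suc t) p f X with p + k ∸ k | m+n∸n≡m p k
  ... | .p | refl with C p | C (suc p)
  ... | false | false = loop≡run t (suc p) f _
  ... | false | true  rewrite m+n∸n≡m p k = loop≡run t (suc p) (suc p) _
  ... | true  | true  = loop≡run t (suc p) f _
  ... | true  | false rewrite m+n∸n≡m p k | suc[p+k∸suc-p]≡k p with continues p f
  ...   | true  = loop≡run t (suc p) f _
  ...   | false = loop≡run t (suc p) f _

  append-run : ∀ t p f → (∀ X → run t p f X ≡ X ++ run t p f []) →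
    ∀ X s → run t p f (X ++ s) ≡ X ++ run t p f s
  append-run t p f accumulates X s =
    trans (accumulates (X ++ s)) (trans (Listₚ.++-assoc X s _) (cong (X ++_) (sym (accumulates s))))

  run-++ : ∀ t p f X → run t p f X ≡ X ++ run t p f []
  run-++ zero p f X = sym (Listₚ.++-identityʳ X)
  run-++ (suc t) p f X with C p | C (suc p)
  ... | false | false = append-run t (suc p) f (run-++ t (suc p) f) X (letterAt p)
  ... | false | true  = run-++ t (suc p) (suc p) X
  ... | true  | true  = run-++ t (suc p) f X
  ... | true  | false = append-run t (suc p) f (run-++ t (suc p) f) X (rejoin p f)

  module _ {t p f : ℕ} where

    run-00 : C p ≡ false → C (suc p) ≡ false → run (suc t) p f [] ≡ letterAt p ++ run t (suc p) f []
    run-00 c₀ c₁ rewrite c₀ | c₁ = run-++ t (suc p) f (letterAt p)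

    run-01 : C p ≡ false → C (suc p) ≡ true → run (suc t) p f [] ≡ run t (suc p) (suc p) []
    run-01 c₀ c₁ rewrite c₀ | c₁ = refl

    run-11 : C p ≡ true → C (suc p) ≡ true → run (suc t) p f [] ≡ run t (suc p) f []
    run-11 c₀ c₁ rewrite c₀ | c₁ = refl

    run-10 : C p ≡ true → C (suc p) ≡ false → run (suc t) p f [] ≡ rejoin p f ++ run t (suc p) f []
    run-10 c₀ c₁ rewrite c₀ | c₁ = run-++ t (suc p) f (rejoin p f)

  tailAt : ℕ → List (Maybe A)
  tailAt q = map just (window W q m)

  length-tailAt : ∀ q → length (tailAt q) < k
  length-tailAt q = s≤s (subst (_≤ m) (sym (trans (Listₚ.length-map just (window W q m)) (Listₚ.length-take m (drop q W))))
                                      (m⊓n≤m m _))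

  take-window : ∀ c → take m (window W c k) ≡ window W c m
  take-window c = trans (Listₚ.take-take m k (drop c W)) (cong (λ r → take r (drop c W)) (m≤n⇒m⊓n≡m (n≤1+n m)))

  drop-window : ∀ c → drop 1 (window W c k) ≡ window W (suc c) m
  drop-window c = trans (drop-1-take k (drop c W)) (cong (take m) (drop-1-drop c W))

  window-++-letterAt : ∀ p → window W (suc p) m ++ window W (p + k) 1 ≡ window W (suc p) k
  window-++-letterAt p =
    trans (cong (λ xs → window W (suc p) m ++ take 1 xs)
            (trans (cong (λ r → drop r W) (+-suc p m)) (sym (Listₚ.drop-drop (suc p) m W))))
    (trans (take-+ m 1 (drop (suc p) W)) (cong (λ r → take r (drop (suc p) W)) (+-comm m 1)))

  takeLast-window : ∀ c → c + k ≤ n → takeLast m (map just (window W c k)) ≡ tailAt (suc c)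
  takeLast-window c c+k≤n =
    trans (cong (λ r → drop (r ∸ m) (map just (window W c k)))
                (trans (Listₚ.length-map just (window W c k)) (window-length W c k c+k≤n)))
    (trans (cong (λ r → drop r (map just (window W c k))) (m+n∸n≡m 1 m))
    (trans (Listₚ.drop-map 1 (window W c k)) (cong (map just) (drop-window c))))

  kmers-window-++ : ∀ c R → c + k ≤ n →
    kmers k (map just (window W c k) ++ R) ≡ map just (window W c k) ∷ kmers k (tailAt (suc c) ++ R)
  kmers-window-++ c R c+k≤n = begin
    kmers k (map just (window W c k) ++ R)
      ≡⟨ kmers-++ m (map just (window W c k)) R ⟩
    kmers k (map just (window W c k)) ++ kmers k (takeLast m (map just (window W c k)) ++ R)
      ≡⟨ cong₂ _++_ (kmers-single k (map just (window W c k)) (s≤s z≤n)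
                      (trans (Listₚ.length-map just (window W c k)) (window-length W c k c+k≤n))
                      (all-just-map-just (window W c k)))
                    (cong (λ z → kmers k (z ++ R)) (takeLast-window c c+k≤n)) ⟩
    map just (window W c k) ∷ kmers k (tailAt (suc c) ++ R) ∎
    where open ≡-Reasoning

  kmers-letterAt : ∀ p R → suc p + k ≤ n →
    kmers k (tailAt (suc p) ++ (letterAt p ++ R)) ≡ map just (window W (suc p) k) ∷ kmers k (tailAt (suc (suc p)) ++ R)
  kmers-letterAt p R le = begin
    kmers k (tailAt (suc p) ++ (letterAt p ++ R))
      ≡⟨ cong (kmers k) (sym (Listₚ.++-assoc (tailAt (suc p)) (letterAt p) R)) ⟩
    kmers k ((tailAt (suc p) ++ letterAt p) ++ R)
      ≡⟨ cong (λ z → kmers k (z ++ R)) (trans (sym (Listₚ.map-++ just (window W (suc p) m) (window W (p + k) 1)))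
                                              (cong (map just) (window-++-letterAt p))) ⟩
    kmers k (map just (window W (suc p) k) ++ R)
      ≡⟨ kmers-window-++ (suc p) R le ⟩
    map just (window W (suc p) k) ∷ kmers k (tailAt (suc (suc p)) ++ R) ∎
    where open ≡-Reasoning

  kmers-restart : ∀ q p R → suc p + k ≤ n →
    kmers k (tailAt q ++ (restart p ++ R)) ≡ map just (window W (suc p) k) ∷ kmers k (tailAt (suc (suc p)) ++ R)
  kmers-restart q p R le = begin
    kmers k (tailAt q ++ (nothing ∷ (map just (window W (suc p) k) ++ R)))
      ≡⟨ kmers-++-# m (tailAt q) _ ⟩
    kmers k (tailAt q) ++ kmers k (map just (window W (suc p) k) ++ R)
      ≡⟨ cong (_++ kmers k (map just (window W (suc p) k) ++ R)) (kmers-short k (tailAt q) (length-tailAt q)) ⟩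
    kmers k (map just (window W (suc p) k) ++ R)
      ≡⟨ kmers-window-++ (suc p) R le ⟩
    map just (window W (suc p) k) ∷ kmers k (tailAt (suc (suc p)) ++ R) ∎
    where open ≡-Reasoning

  nonSensitive : ℕ → ℕ → List (List A)
  nonSensitive s t = map (λ q → window W q k) (filterᵇ (not ∘ C) (interval s t))

  nonSensitive-accept : ∀ {s t} → C s ≡ false → nonSensitive s (suc t) ≡ window W s k ∷ nonSensitive (suc s) t
  nonSensitive-accept {s} {t} c = cong (map (λ q → window W q k)) (filterᵇ-accept (not ∘ C) (interval (suc s) t) (cong not c))

  nonSensitive-reject : ∀ {s t} → C s ≡ true → nonSensitive s (suc t) ≡ nonSensitive (suc s) t
  nonSensitive-reject {s} {t} c = cong (map (λ q → window W q k)) (filterᵇ-reject (not ∘ C) (interval (suc s) t) (cong not c))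

  -- where the last k - 1 letters of the output so far start in W, given C[p]
  tailStart : Bool → ℕ → ℕ → ℕ
  tailStart false p f = suc p
  tailStart true  p f = f

  remaining : ∀ {p t} → p + k + suc t ≤ n → suc p + k + t ≤ n
  remaining {p} {t} le = subst (_≤ n) (+-suc (p + k) t) le

  next-fits : ∀ {p t} → p + k + suc t ≤ n → suc p + k ≤ n
  next-fits {p} {t} le = m+n≤o⇒m≤o (suc p + k) (remaining {p} {t} le)

  kmers-run : ∀ t p f b → C p ≡ b → p + k + t ≤ n →
    kmers k (tailAt (tailStart b p f) ++ run t p f []) ≡ map (map just) (nonSensitive (suc p) t)
  kmers-run zero p f b _ _ =
    trans (cong (kmers k) (Listₚ.++-identityʳ (tailAt (tailStart b p f))))
          (kmers-short k (tailAt (tailStart b p f)) (length-tailAt (tailStart b p f)))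
  kmers-run (suc t) p f b c₀ le = step b c₀ (C (suc p)) refl
    where
    step : ∀ b → C p ≡ b → ∀ b₁ → C (suc p) ≡ b₁ →
      kmers k (tailAt (tailStart b p f) ++ run (suc t) p f []) ≡ map (map just) (nonSensitive (suc p) (suc t))
    step false c₀ false c₁ = begin
      kmers k (tailAt (suc p) ++ run (suc t) p f [])
        ≡⟨ cong (λ z → kmers k (tailAt (suc p) ++ z)) (run-00 c₀ c₁) ⟩
      kmers k (tailAt (suc p) ++ (letterAt p ++ run t (suc p) f []))
        ≡⟨ kmers-letterAt p _ (next-fits {p} {t} le) ⟩
      map just (window W (suc p) k) ∷ kmers k (tailAt (suc (suc p)) ++ run t (suc p) f [])
        ≡⟨ cong (map just (window W (suc p) k) ∷_) (kmers-run t (suc p) f false c₁ (remaining {p} {t} le)) ⟩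
      map (map just) (window W (suc p) k ∷ nonSensitive (suc (suc p)) t)
        ≡⟨ cong (map (map just)) (sym (nonSensitive-accept c₁)) ⟩
      map (map just) (nonSensitive (suc p) (suc t)) ∎
      where open ≡-Reasoning
    step false c₀ true c₁ = begin
      kmers k (tailAt (suc p) ++ run (suc t) p f [])
        ≡⟨ cong (λ z → kmers k (tailAt (suc p) ++ z)) (run-01 c₀ c₁) ⟩
      kmers k (tailAt (suc p) ++ run t (suc p) (suc p) [])
        ≡⟨ kmers-run t (suc p) (suc p) true c₁ (remaining {p} {t} le) ⟩
      map (map just) (nonSensitive (suc (suc p)) t)
        ≡⟨ cong (map (map just)) (sym (nonSensitive-reject c₁)) ⟩
      map (map just) (nonSensitive (suc p) (suc t)) ∎
      where open ≡-Reasoning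
    step true c₀ true c₁ = begin
      kmers k (tailAt f ++ run (suc t) p f [])
        ≡⟨ cong (λ z → kmers k (tailAt f ++ z)) (run-11 c₀ c₁) ⟩
      kmers k (tailAt f ++ run t (suc p) f [])
        ≡⟨ kmers-run t (suc p) f true c₁ (remaining {p} {t} le) ⟩
      map (map just) (nonSensitive (suc (suc p)) t)
        ≡⟨ cong (map (map just)) (sym (nonSensitive-reject c₁)) ⟩
      map (map just) (nonSensitive (suc p) (suc t)) ∎
      where open ≡-Reasoning
    step true c₀ false c₁ = begin
      kmers k (tailAt f ++ run (suc t) p f [])
        ≡⟨ cong (λ z → kmers k (tailAt f ++ z)) (run-10 c₀ c₁) ⟩
      kmers k (tailAt f ++ (rejoin p f ++ R))
        ≡⟨ kmers-rejoin ⟩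
      map just (window W (suc p) k) ∷ kmers k (tailAt (suc (suc p)) ++ R)
        ≡⟨ cong (map just (window W (suc p) k) ∷_) (kmers-run t (suc p) f false c₁ (remaining {p} {t} le)) ⟩
      map (map just) (window W (suc p) k ∷ nonSensitive (suc (suc p)) t)
        ≡⟨ cong (map (map just)) (sym (nonSensitive-accept c₁)) ⟩
      map (map just) (nonSensitive (suc p) (suc t)) ∎
      where
      open ≡-Reasoning
      R = run t (suc p) f []
      kmers-rejoin : kmers k (tailAt f ++ (rejoin p f ++ R)) ≡ map just (window W (suc p) k) ∷ kmers k (tailAt (suc (suc p)) ++ R)
      kmers-rejoin with continues p f in same
      ... | true  = trans (cong (λ z → kmers k (map just z ++ (letterAt p ++ R)))
                                (sym (does-true (_≟L_ _≟A_ (window W (suc p) m) (window W f m)) same)))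
                          (kmers-letterAt p R (next-fits {p} {t} le))
      ... | false = kmers-restart f p R (next-fits {p} {t} le)

  open Spelling (_≟L_ _≟A_) k

  length-letterAt : ∀ p → p + k < n → length (letterAt p) ≡ 1
  length-letterAt p lt = trans (Listₚ.length-map just (window W (p + k) 1)) (window-length W (p + k) 1 (subst (_≤ n) (+-comm 1 (p + k)) lt))

  length-restart : ∀ p → suc p + k ≤ n → length (restart p) ≡ suc k
  length-restart p le = cong suc (trans (Listₚ.length-map just (window W (suc p) k)) (window-length W (suc p) k le))

  letter-fits : ∀ {p t} → p + k + suc t ≤ n → p + k < n
  letter-fits {p} {t} le = m+n≤o⇒m≤o (suc (p + k)) (subst (_≤ n) (+-suc (p + k) t) le)

  length-run : ∀ t p f b → C p ≡ b → p + k + t ≤ n → ∀ v → drop 1 v ≡ window W (tailStart b p f) m →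
    length (run t p f []) ≡ spellLengthAfter v (nonSensitive (suc p) t)
  length-run zero p f b _ _ v _ = refl
  length-run (suc t) p f b c₀ le v v-tail = step b c₀ (C (suc p)) refl v-tail
    where
    open ≡-Reasoning
    R = run t (suc p) f []
    next = window W (suc p) k
    overlaps : drop 1 v ≡ window W (suc p) m → joinCost v next ≡ 1
    overlaps v-tail = joinCost-overlap v next (trans (take-window (suc p)) (sym v-tail))
    step : ∀ b → C p ≡ b → ∀ b₁ → C (suc p) ≡ b₁ → drop 1 v ≡ window W (tailStart b p f) m →
      length (run (suc t) p f []) ≡ spellLengthAfter v (nonSensitive (suc p) (suc t))
    step false c₀ false c₁ v-tail = begin
      length (run (suc t) p f [])          ≡⟨ cong length (run-00 c₀ c₁) ⟩
      length (letterAt p ++ R)             ≡⟨ Listₚ.length-++ (letterAt p) ⟩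
      length (letterAt p) + length R
        ≡⟨ cong₂ _+_ (trans (length-letterAt p (letter-fits {p} {t} le)) (sym (overlaps v-tail)))
                     (length-run t (suc p) f false c₁ (remaining {p} {t} le) next (drop-window (suc p))) ⟩
      spellLengthAfter v (next ∷ nonSensitive (suc (suc p)) t)
        ≡⟨ cong (spellLengthAfter v) (sym (nonSensitive-accept c₁)) ⟩
      spellLengthAfter v (nonSensitive (suc p) (suc t)) ∎
    step false c₀ true c₁ v-tail = begin
      length (run (suc t) p f [])          ≡⟨ cong length (run-01 c₀ c₁) ⟩
      length (run t (suc p) (suc p) [])    ≡⟨ length-run t (suc p) (suc p) true c₁ (remaining {p} {t} le) v v-tail ⟩
      spellLengthAfter v (nonSensitive (suc (suc p)) t)
        ≡⟨ cong (spellLengthAfter v) (sym (nonSensitive-reject c₁)) ⟩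
      spellLengthAfter v (nonSensitive (suc p) (suc t)) ∎
    step true c₀ true c₁ v-tail = begin
      length (run (suc t) p f [])          ≡⟨ cong length (run-11 c₀ c₁) ⟩
      length R                             ≡⟨ length-run t (suc p) f true c₁ (remaining {p} {t} le) v v-tail ⟩
      spellLengthAfter v (nonSensitive (suc (suc p)) t)
        ≡⟨ cong (spellLengthAfter v) (sym (nonSensitive-reject c₁)) ⟩
      spellLengthAfter v (nonSensitive (suc p) (suc t)) ∎
    step true c₀ false c₁ v-tail = begin
      length (run (suc t) p f [])          ≡⟨ cong length (run-10 c₀ c₁) ⟩
      length (rejoin p f ++ R)             ≡⟨ Listₚ.length-++ (rejoin p f) ⟩
      length (rejoin p f) + length R
        ≡⟨ cong₂ _+_ length-rejoin (length-run t (suc p) f false c₁ (remaining {p} {t} le) next (drop-window (suc p))) ⟩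
      spellLengthAfter v (next ∷ nonSensitive (suc (suc p)) t)
        ≡⟨ cong (spellLengthAfter v) (sym (nonSensitive-accept c₁)) ⟩
      spellLengthAfter v (nonSensitive (suc p) (suc t)) ∎
      where
      length-rejoin : length (rejoin p f) ≡ joinCost v next
      length-rejoin rewrite take-window (suc p) | v-tail with continues p f
      ... | true  = length-letterAt p (letter-fits {p} {t} le)
      ... | false = length-restart p (next-fits {p} {t} le)

  -- bounds on |run t p f []| and on its number of #, according to C[p]
  maxLength : Bool → ℕ → ℕ
  maxLength false zero    = 0
  maxLength true  zero    = 1
  maxLength false (suc t) = maxLength true t
  maxLength true  (suc t) = suc k + maxLength false t

  maxHashes : Bool → ℕ → ℕ
  maxHashes false t = ⌊ t /2⌋
  maxHashes true  t = ⌊ suc t /2⌋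

  maxLength-steps : ∀ t → suc (maxLength false t) ≤ maxLength true t × suc (maxLength true t) ≤ suc k + maxLength false t
  maxLength-steps zero = s≤s z≤n , s≤s (s≤s z≤n)
  maxLength-steps (suc t) with maxLength-steps t
  ... | 0<1 , 1<0 = 1<0 , subst (_≤ suc k + maxLength true t) (+-suc (suc k) (maxLength false t)) (+-monoʳ-≤ (suc k) 0<1)

  maxLength-mono : ∀ {a b} → a ≤ b → maxLength false a ≤ maxLength false b
  maxLength-mono {a} {zero} z≤n = z≤n
  maxLength-mono {a} {suc b} a≤ with m≤n⇒m<n∨m≡n a≤
  ... | inj₂ refl = ≤-refl
  ... | inj₁ (s≤s a≤b) = ≤-trans (maxLength-mono a≤b) (≤-trans (n≤1+n _) (proj₁ (maxLength-steps b)))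

  maxLength-closed : ∀ t → k + maxLength false t ≡ ⌈ suc t /2⌉ * k + ⌊ suc t /2⌋
  maxLength-closed zero = sym (+-identityʳ (k + 0))
  maxLength-closed (suc zero) = cong (_+ 1) (sym (+-identityʳ k))
  maxLength-closed (suc (suc t)) = begin
    k + (suc k + maxLength false t)                ≡⟨ +-suc k (k + maxLength false t) ⟩
    suc (k + (k + maxLength false t))              ≡⟨ cong (λ z → suc (k + z)) (maxLength-closed t) ⟩
    suc (k + (⌈ suc t /2⌉ * k + ⌊ suc t /2⌋))      ≡⟨ cong suc (sym (+-assoc k _ _)) ⟩
    suc (k + ⌈ suc t /2⌉ * k + ⌊ suc t /2⌋)        ≡⟨ sym (+-suc (k + ⌈ suc t /2⌉ * k) _) ⟩
    ⌈ suc (suc (suc t)) /2⌉ * k + ⌊ suc (suc (suc t)) /2⌋ ∎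
    where open ≡-Reasoning

  maxLength≡bound : k + maxLength false (n ∸ k) ≡ bound n k
  maxLength≡bound = trans (maxLength-closed (n ∸ k)) (cong (λ r → ⌈ r /2⌉ * k + ⌊ r /2⌋) (+-comm 1 (n ∸ k)))

  length-letterAt-≤ : ∀ p → length (letterAt p) ≤ 1
  length-letterAt-≤ p = subst (_≤ 1) (sym (trans (Listₚ.length-map just (window W (p + k) 1)) (Listₚ.length-take 1 (drop (p + k) W))))
                          (m⊓n≤m 1 _)

  length-rejoin-≤ : ∀ p f → length (rejoin p f) ≤ suc k
  length-rejoin-≤ p f with continues p f
  ... | true  = ≤-trans (length-letterAt-≤ p) (s≤s z≤n)
  ... | false = s≤s (subst (_≤ k) (sym (trans (Listₚ.length-map just (window W (suc p) k)) (Listₚ.length-take k (drop (suc p) W))))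
                       (m⊓n≤m k _))

  countHash-rejoin-≤ : ∀ p f → countHash (rejoin p f) ≤ 1
  countHash-rejoin-≤ p f with continues p f
  ... | true  = ≤-trans (≤-reflexive (countHash-map-just (window W (p + k) 1))) z≤n
  ... | false = ≤-reflexive (cong suc (countHash-map-just (window W (suc p) k)))

  length-run-≤ : ∀ t p f b → C p ≡ b → length (run t p f []) ≤ maxLength b t
  length-run-≤ zero p f b _ = z≤n
  length-run-≤ (suc t) p f b c₀ = step b c₀ (C (suc p)) refl
    where
    step : ∀ b → C p ≡ b → ∀ b₁ → C (suc p) ≡ b₁ → length (run (suc t) p f []) ≤ maxLength b (suc t)
    step false c₀ false c₁ rewrite run-00 {t} {p} {f} c₀ c₁ | Listₚ.length-++ (letterAt p) {run t (suc p) f []} =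
      ≤-trans (+-mono-≤ (length-letterAt-≤ p) (length-run-≤ t (suc p) f false c₁)) (proj₁ (maxLength-steps t))
    step false c₀ true  c₁ rewrite run-01 {t} {p} {f} c₀ c₁ = length-run-≤ t (suc p) (suc p) true c₁
    step true  c₀ true  c₁ rewrite run-11 {t} {p} {f} c₀ c₁ =
      ≤-trans (length-run-≤ t (suc p) f true c₁) (≤-trans (n≤1+n _) (proj₂ (maxLength-steps t)))
    step true  c₀ false c₁ rewrite run-10 {t} {p} {f} c₀ c₁ | Listₚ.length-++ (rejoin p f) {run t (suc p) f []} =
      +-mono-≤ (length-rejoin-≤ p f) (length-run-≤ t (suc p) f false c₁)

  countHash-run-≤ : ∀ t p f b → C p ≡ b → countHash (run t p f []) ≤ maxHashes b t
  countHash-run-≤ zero p f b _ = z≤n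
  countHash-run-≤ (suc t) p f b c₀ = step b c₀ (C (suc p)) refl
    where
    step : ∀ b → C p ≡ b → ∀ b₁ → C (suc p) ≡ b₁ → countHash (run (suc t) p f []) ≤ maxHashes b (suc t)
    step false c₀ false c₁ rewrite run-00 {t} {p} {f} c₀ c₁ | countHash-++ (letterAt p) (run t (suc p) f [])
                                 | countHash-map-just (window W (p + k) 1) =
      ≤-trans (countHash-run-≤ t (suc p) f false c₁) (⌊n/2⌋-mono (n≤1+n t))
    step false c₀ true  c₁ rewrite run-01 {t} {p} {f} c₀ c₁ = countHash-run-≤ t (suc p) (suc p) true c₁
    step true  c₀ true  c₁ rewrite run-11 {t} {p} {f} c₀ c₁ =
      ≤-trans (countHash-run-≤ t (suc p) f true c₁) (⌊n/2⌋-mono (n≤1+n (suc t)))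
    step true  c₀ false c₁ rewrite run-10 {t} {p} {f} c₀ c₁ | countHash-++ (rejoin p f) (run t (suc p) f []) =
      +-mono-≤ (countHash-rejoin-≤ p f) (countHash-run-≤ t (suc p) f false c₁)

  spaced-run : ∀ t p f → p + k + t ≤ n → Spaced k (run t p f [])
  spaced-run zero p f _ = []
  spaced-run (suc t) p f le = step (C p) refl (C (suc p)) refl
    where
    rest : ∀ f′ → Spaced k (run t (suc p) f′ [])
    rest f′ = spaced-run t (suc p) f′ (remaining {p} {t} le)
    step : ∀ b → C p ≡ b → ∀ b₁ → C (suc p) ≡ b₁ → Spaced k (run (suc t) p f [])
    step false c₀ false c₁ rewrite run-00 {t} {p} {f} c₀ c₁ = spaced-map-just (window W (p + k) 1) (rest f)
    step false c₀ true  c₁ rewrite run-01 {t} {p} {f} c₀ c₁ = rest (suc p)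
    step true  c₀ true  c₁ rewrite run-11 {t} {p} {f} c₀ c₁ = rest f
    step true  c₀ false c₁ rewrite run-10 {t} {p} {f} c₀ c₁ with continues p f
    ... | true  = spaced-map-just (window W (p + k) 1) (rest f)
    ... | false = hash (window W (suc p) k) (window-length W (suc p) k (next-fits {p} {t} le)) (rest f)

  findZero-just : ∀ t s {j} → findZero t s ≡ just j →
    (∀ i → s ≤ i → i < j → C i ≡ true) × C j ≡ false × j < s + t
  findZero-just (suc t) s {j} e with C s in cₛ
  findZero-just (suc t) s refl | false =
    (λ i s≤i i<s → ⊥-elim (<-irrefl refl (≤-<-trans s≤i i<s))) , cₛ , subst (s <_) (sym (+-suc s t)) (s≤s (m≤m+n s t))
  ... | true with findZero-just t (suc s) e
  ... | before , cⱼ , j< = sensitive , cⱼ , subst (j <_) (sym (+-suc s t)) j<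
    where
    sensitive : ∀ i → s ≤ i → i < j → C i ≡ true
    sensitive i s≤i i<j with m≤n⇒m<n∨m≡n s≤i
    ... | inj₂ refl = cₛ
    ... | inj₁ s<i  = before i s<i i<j

  findZero-nothing : ∀ t s → findZero t s ≡ nothing → ∀ i → s ≤ i → i < s + t → C i ≡ true
  findZero-nothing zero s _ i s≤i i< = ⊥-elim (<-irrefl refl (≤-<-trans s≤i (subst (i <_) (+-identityʳ s) i<)))
  findZero-nothing (suc t) s e i s≤i i< with C s in cₛ
  ... | true with m≤n⇒m<n∨m≡n s≤i
  ...   | inj₂ refl = cₛ
  ...   | inj₁ s<i  = findZero-nothing t (suc s) e i s<i (subst (i <_) (+-suc s t) i<)

  nonSensitive-none : ∀ t s → (∀ i → s ≤ i → i < s + t → C i ≡ true) → nonSensitive s t ≡ []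
  nonSensitive-none zero s _ = refl
  nonSensitive-none (suc t) s sens =
    trans (nonSensitive-reject (sens s ≤-refl (subst (s <_) (sym (+-suc s t)) (s≤s (m≤m+n s t)))))
          (nonSensitive-none t (suc s) (λ i s<i i< → sens i (<⇒≤ s<i) (subst (i <_) (sym (+-suc s t)) i<)))

  nonSensitive-skip : ∀ t s j → (∀ i → s ≤ i → i < j → C i ≡ true) → s ≤ j → j ≤ s + t →
    nonSensitive s t ≡ nonSensitive j (s + t ∸ j)
  nonSensitive-skip t s j sens s≤j j≤ with m≤n⇒m<n∨m≡n s≤j
  ... | inj₂ refl = cong (nonSensitive s) (sym (m+n∸m≡n s t))
  nonSensitive-skip zero s j sens s≤j j≤ | inj₁ s<j = ⊥-elim (<-irrefl refl (<-≤-trans s<j (subst (j ≤_) (+-identityʳ s) j≤)))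
  nonSensitive-skip (suc t) s j sens s≤j j≤ | inj₁ s<j =
    trans (nonSensitive-reject (sens s ≤-refl s<j))
    (trans (nonSensitive-skip t (suc s) j (λ i s<i i<j → sens i (<⇒≤ s<i) i<j) s<j (subst (j ≤_) (+-suc s t) j≤))
           (cong (λ r → nonSensitive j (r ∸ j)) (sym (+-suc s t))))

  plainKmers : List (List A)
  plainKmers = nonSensitive 0 (suc (n ∸ k))

  output-C0 : C 0 ≡ false → 0 < n → output ≡ map just (window W 0 k) ++ run (n ∸ k) 0 0 []
  output-C0 c₀ 0<n = trans (cong start (findZero-0 n 0<n))
    (trans (loop≡run (n ∸ k) 0 0 (map just (window W 0 k))) (run-++ (n ∸ k) 0 0 (map just (window W 0 k))))
    where
    findZero-0 : ∀ t → 0 < t → findZero t 0 ≡ just 0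
    findZero-0 (suc t) _ rewrite c₀ = refl

  module Output (k<n : k < n) (C-tail : ∀ i → n ∸ k ≤ i → C i ≡ C (n ∸ k)) where

    data OutputView : Set where
      noPlain    : plainKmers ≡ [] → output ≡ [] → OutputView
      firstPlain : ∀ j₀ → j₀ + k ≤ n → C j₀ ≡ false →
        plainKmers ≡ window W j₀ k ∷ nonSensitive (suc j₀) (n ∸ (j₀ + k)) →
        output ≡ map just (window W j₀ k) ++ run (n ∸ (j₀ + k)) j₀ 0 [] → OutputView

    outputView : OutputView
    outputView with findZero n 0 in found
    ... | nothing =
      noPlain (nonSensitive-none (suc (n ∸ k)) 0 λ i _ i< → findZero-nothing n 0 found i z≤n (<-≤-trans i< n-k<n))
              (cong start found)
      where
      n-k<n : suc (n ∸ k) ≤ n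
      n-k<n = ∸-monoʳ-< {n} {k} {0} (s≤s z≤n) (<⇒≤ k<n)
    ... | just j₀ with findZero-just n 0 found
    ...   | before , c₀ , _ = firstPlain j₀ fits c₀ plain-from-j₀
                                (trans (cong start found) (trans (loop≡run t₀ j₀ 0 _) (run-++ t₀ j₀ 0 _)))
      where
      t₀ = n ∸ (j₀ + k)
      -- findZero scans all of C, whose entries beyond n - k repeat C[n - k]
      j₀≤ : j₀ ≤ n ∸ k
      j₀≤ with j₀ ≤? n ∸ k
      ... | yes le = le
      ... | no  gt with trans (sym c₀) (trans (C-tail j₀ (<⇒≤ (≰⇒> gt))) (before (n ∸ k) z≤n (≰⇒> gt)))
      ...   | ()
      fits : j₀ + k ≤ n
      fits = m≤o∸n⇒m+n≤o j₀ (<⇒≤ k<n) j₀≤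
      plain-from-j₀ : plainKmers ≡ window W j₀ k ∷ nonSensitive (suc j₀) t₀
      plain-from-j₀ = trans (nonSensitive-skip (suc (n ∸ k)) 0 j₀ before z≤n (≤-trans j₀≤ (n≤1+n _)))
        (trans (cong (nonSensitive j₀) (trans (+-∸-assoc 1 j₀≤) (cong suc (trans (∸-+-assoc n k j₀) (cong (n ∸_) (+-comm k j₀))))))
               (nonSensitive-accept c₀))

    kmers-output : kmers k output ≡ map (map just) plainKmers
    kmers-output with outputView
    ... | noPlain none out = trans (cong (kmers k) out) (cong (map (map just)) (sym none))
    ... | firstPlain j₀ fits c₀ plain out = begin
      kmers k output                                               ≡⟨ cong (kmers k) out ⟩
      kmers k (map just (window W j₀ k) ++ R)                      ≡⟨ kmers-window-++ j₀ R fits ⟩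
      map just (window W j₀ k) ∷ kmers k (tailAt (suc j₀) ++ R)    ≡⟨ cong (map just (window W j₀ k) ∷_)
                                                                         (kmers-run (n ∸ (j₀ + k)) j₀ 0 false c₀ (≤-reflexive (m+[n∸m]≡n fits))) ⟩
      map (map just) (window W j₀ k ∷ nonSensitive (suc j₀) (n ∸ (j₀ + k)))     ≡⟨ cong (map (map just)) (sym plain) ⟩
      map (map just) plainKmers                                    ∎
      where
      open ≡-Reasoning
      R = run (n ∸ (j₀ + k)) j₀ 0 []

    length-output : length output ≡ spellLength plainKmers
    length-output with outputView
    ... | noPlain none out = trans (cong length out) (cong spellLength (sym none))
    ... | firstPlain j₀ fits c₀ plain out = begin
      length output                                          ≡⟨ cong length out ⟩
      length (map just (window W j₀ k) ++ R)                 ≡⟨ Listₚ.length-++ (map just (window W j₀ k)) ⟩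
      length (map just (window W j₀ k)) + length R
        ≡⟨ cong₂ _+_ (trans (Listₚ.length-map just (window W j₀ k)) (window-length W j₀ k fits))
                     (length-run (n ∸ (j₀ + k)) j₀ 0 false c₀ (≤-reflexive (m+[n∸m]≡n fits)) (window W j₀ k) (drop-window j₀)) ⟩
      spellLength (window W j₀ k ∷ nonSensitive (suc j₀) (n ∸ (j₀ + k)))  ≡⟨ cong spellLength (sym plain) ⟩
      spellLength plainKmers                                 ∎
      where
      open ≡-Reasoning
      R = run (n ∸ (j₀ + k)) j₀ 0 []

    length-output-≤ : length output ≤ bound n k
    length-output-≤ with outputView
    ... | noPlain _ out = subst (_≤ bound n k) (sym (cong length out)) z≤n
    ... | firstPlain j₀ fits c₀ _ out = begin
      length output                                 ≡⟨ cong length out ⟩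
      length (map just (window W j₀ k) ++ R)        ≡⟨ Listₚ.length-++ (map just (window W j₀ k)) ⟩
      length (map just (window W j₀ k)) + length R  ≡⟨ cong (_+ length R) (trans (Listₚ.length-map just (window W j₀ k)) (window-length W j₀ k fits)) ⟩
      k + length R                                  ≤⟨ +-monoʳ-≤ k (length-run-≤ (n ∸ (j₀ + k)) j₀ 0 false c₀) ⟩
      k + maxLength false (n ∸ (j₀ + k))            ≤⟨ +-monoʳ-≤ k (maxLength-mono (∸-monoʳ-≤ n (m≤n+m k j₀))) ⟩
      k + maxLength false (n ∸ k)                   ≡⟨ maxLength≡bound ⟩
      bound n k                                     ∎
      where
      open ≤-Reasoning
      R = run (n ∸ (j₀ + k)) j₀ 0 []

    countHash-output-≤ : countHash output ≤ ⌊ (n ∸ k + 1) /2⌋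
    countHash-output-≤ with outputView
    ... | noPlain _ out = subst (_≤ ⌊ (n ∸ k + 1) /2⌋) (sym (cong countHash out)) z≤n
    ... | firstPlain j₀ fits c₀ _ out = begin
      countHash output                                        ≡⟨ cong countHash out ⟩
      countHash (map just (window W j₀ k) ++ R)               ≡⟨ countHash-++ (map just (window W j₀ k)) R ⟩
      countHash (map just (window W j₀ k)) + countHash R      ≡⟨ cong (_+ countHash R) (countHash-map-just (window W j₀ k)) ⟩
      countHash R                                             ≤⟨ countHash-run-≤ (n ∸ (j₀ + k)) j₀ 0 false c₀ ⟩
      ⌊ n ∸ (j₀ + k) /2⌋                                      ≤⟨ ⌊n/2⌋-mono (≤-trans (∸-monoʳ-≤ n (m≤n+m k j₀)) (m≤m+n (n ∸ k) 1)) ⟩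
      ⌊ (n ∸ k + 1) /2⌋                                       ∎
      where
      open ≤-Reasoning
      R = run (n ∸ (j₀ + k)) j₀ 0 []

    spaced-output : Spaced k output
    spaced-output with outputView
    ... | noPlain _ out = subst (Spaced k) (sym out) []
    ... | firstPlain j₀ fits c₀ _ out =
      subst (Spaced k) (sym out) (spaced-map-just (window W j₀ k) (spaced-run (n ∸ (j₀ + k)) j₀ 0 (≤-reflexive (m+[n∸m]≡n fits))))

module Correctness {A : Set} (_≟A_ : DecidableEquality A) (W : List A) (m : ℕ) (S : ℕ → Bool)
  (k<n : suc m < length W) (valid : ValidS W (suc m) S) where

  C : ℕ → Bool
  C = Carray W (suc m) S

  open Run _≟A_ W m C public

  C-tail : ∀ i → n ∸ k ≤ i → C i ≡ C (n ∸ k)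
  C-tail i le = cong S (trans (m≥n⇒m⊓n≡n le) (sym (⊓-idem (n ∸ k))))

  C≡S : ∀ q → q + k ≤ n → C q ≡ S q
  C≡S q le = cong S (m≤n⇒m⊓n≡m (m+n≤o⇒m≤o∸n q le))

  open Output k<n C-tail public

  X : List (Maybe A)
  X = tfs _≟A_ W k C

  isSensitive : List (Maybe A) → Bool
  isSensitive = isSens _≟A_ W k S

  isSensitive⇒ : ∀ V → isSensitive V ≡ true → ∃ λ i → S i ≡ true × i + k ≤ n × map just (window W i k) ≡ V
  isSensitive⇒ V e with any-true⁻ _ (upTo (suc n)) e
  ... | i , found with ∧-conicalˡ (S i) _ found | ∧-conicalʳ (S i) _ found
  ...   | sᵢ | rest = i , sᵢ , does-true (i + k ≤? n) (∧-conicalˡ _ _ rest) ,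
                      does-true (_≟LM_ _≟A_ (map just (window W i k)) V) (∧-conicalʳ _ _ rest)

  isSensitive-window : ∀ q → q + k ≤ n → isSensitive (map just (window W q k)) ≡ S q
  isSensitive-window q le with S q in sq
  ... | true = any-true⁺ _ (upTo (suc n)) (∈-upTo⁺ (s≤s (m+n≤o⇒m≤o q le)))
                 (trans (cong (λ b → b ∧ does (q + k ≤? n) ∧ same-window) sq)
                        (trans (cong (_∧ same-window) (dec-true (q + k ≤? n) le))
                               (dec-true (_≟LM_ _≟A_ (map just (window W q k)) (map just (window W q k))) refl)))
    where same-window = does (_≟LM_ _≟A_ (map just (window W q k)) (map just (window W q k)))
  ... | false with isSensitive (map just (window W q k)) in sens
  ...   | false = refl
  ...   | true with isSensitive⇒ _ sens
  ...     | i , sᵢ , i-fits , same with trans (sym sq) (proj₂ valid i q sᵢ le (sym (Listₚ.map-injective just-injective same)))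
  ...       | ()

  isPlain : List (Maybe A) → Bool
  isPlain w = not (isSensitive w)

  map-window-Iset : ∀ U → map (λ j → window U j k) (Iset _≟A_ W k S U) ≡ filterᵇ isPlain (kmers k U)
  map-window-Iset U = begin
    map (λ j → window U j k) (Iset _≟A_ W k S U)
      ≡⟨ map-filterᵇ (λ j → window U j k) inI′ (upTo (length U)) ⟩
    filterᵇ inI′ (map (λ j → window U j k) (upTo (length U)))
      ≡⟨ cong (filterᵇ inI′) (map-window-upTo k U) ⟩
    filterᵇ inI′ (windows k U)
      ≡⟨ filterᵇ-cong inI′ (λ w → isKmer k w ∧ isPlain w) (windows k U) (λ w _ → sym (∧-assoc (does (length w ≟ k)) _ _)) ⟩
    filterᵇ (λ w → isKmer k w ∧ isPlain w) (windows k U)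
      ≡⟨ filterᵇ-∧ (isKmer k) isPlain (windows k U) ⟩
    filterᵇ isPlain (kmers k U) ∎
    where
    open ≡-Reasoning
    inI′ : List (Maybe A) → Bool
    inI′ w = does (length w ≟ k) ∧ is-just (allJust w) ∧ isPlain w

  window-fits : ∀ {q} → q < suc (n ∸ k) → q + k ≤ n
  window-fits {q} (s≤s q≤) = m≤o∸n⇒m+n≤o q (<⇒≤ k<n) q≤

  positions : List ℕ
  positions = interval 0 (suc (n ∸ k))

  ∈-positions⇒fits : ∀ {q} → q ∈ positions → q + k ≤ n
  ∈-positions⇒fits q∈ = window-fits (proj₂ (∈-interval⁻ 0 (suc (n ∸ k)) q∈))

  ∈-plainKmers⁻ : ∀ {w} → w ∈ plainKmers → ∃ λ q → q + k ≤ n × C q ≡ false × w ≡ window W q k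
  ∈-plainKmers⁻ w∈ with ∈-map⁻ (λ q → window W q k) w∈
  ... | q , q∈ , refl with ∈-filterᵇ⁻ (not ∘ C) q∈
  ... | q∈′ , plain = q , ∈-positions⇒fits q∈′ , not-injective plain , refl

  isPlain-window : ∀ q → q + k ≤ n → isPlain (map just (window W q k)) ≡ not (C q)
  isPlain-window q le = cong not (trans (isSensitive-window q le) (sym (C≡S q le)))

  plainKmers-plain : filterᵇ isPlain (map (map just) plainKmers) ≡ map (map just) plainKmers
  plainKmers-plain = filterᵇ-all isPlain _ plain
    where
    plain : ∀ w → w ∈ map (map just) plainKmers → isPlain w ≡ true
    plain w w∈ with ∈-map⁻ (map just) w∈
    ... | v , v∈ , refl with ∈-plainKmers⁻ v∈
    ... | q , fits , c , refl = trans (isPlain-window q fits) (cong not c)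

  kmers-W : kmers k (map just W) ≡ map (λ q → map just (window W q k)) positions
  kmers-W = trans (kmers-map-just m W) (cong (λ r → map (λ q → map just (window W q k)) (interval 0 r)) n∸m≡)
    where
    n∸m≡ : n ∸ m ≡ suc (n ∸ k)
    n∸m≡ = trans (cong (_∸ m) (sym (m+[n∸m]≡n (<⇒≤ k<n))))
                 (trans (cong (_∸ m) (sym (+-suc m (n ∸ k)))) (m+n∸m≡n m (suc (n ∸ k))))

  plain-kmers-W : filterᵇ isPlain (kmers k (map just W)) ≡ map (map just) plainKmers
  plain-kmers-W = begin
    filterᵇ isPlain (kmers k (map just W))
      ≡⟨ cong (filterᵇ isPlain) kmers-W ⟩
    filterᵇ isPlain (map (map just ∘ w) positions)
      ≡⟨ sym (map-filterᵇ (map just ∘ w) isPlain positions) ⟩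
    map (map just ∘ w) (filterᵇ (isPlain ∘ map just ∘ w) positions)
      ≡⟨ cong (map (map just ∘ w)) (filterᵇ-cong _ (not ∘ C) positions (λ q q∈ → isPlain-window q (∈-positions⇒fits q∈))) ⟩
    map (map just ∘ w) (filterᵇ (not ∘ C) positions)
      ≡⟨ Listₚ.map-∘ (filterᵇ (not ∘ C) positions) ⟩
    map (map just) plainKmers ∎
    where
    open ≡-Reasoning
    w : ℕ → List A
    w q = window W q k

  plain-kmers : ∀ Y → filterᵇ isPlain (kmers k Y) ≡ map (map just) plainKmers → CondII _≟A_ W k S Y
  plain-kmers Y e = begin
    map (λ j → window (map just W) j k) (Iset _≟A_ W k S (map just W)) ≡⟨ map-window-Iset (map just W) ⟩
    filterᵇ isPlain (kmers k (map just W))                             ≡⟨ trans plain-kmers-W (sym e) ⟩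
    filterᵇ isPlain (kmers k Y)                                        ≡⟨ sym (map-window-Iset Y) ⟩
    map (λ j → window Y j k) (Iset _≟A_ W k S Y)                       ∎
    where open ≡-Reasoning

  condII : CondII _≟A_ W k S X
  condII = plain-kmers X (trans (cong (filterᵇ isPlain) kmers-output) plainKmers-plain)

  occurs⇒∈-kmers : ∀ (Y P : List (Maybe A)) → length P ≡ k → all is-just P ≡ true → Occurs P Y → P ∈ kmers k Y
  occurs⇒∈-kmers Y P ℓ letters (j , fits , at-j) = ∈-filterᵇ⁺ (isKmer k) P∈ (isKmer-accept k P ℓ letters)
    where
    j<Y : j < length Y
    j<Y = <-≤-trans (subst (λ x → j < j + x) (sym ℓ) (m<m+n j (s≤s z≤n))) fits
    P∈ : P ∈ windows k Y
    P∈ = subst (_∈ windows k Y) (trans (cong (window Y j) (sym ℓ)) at-j) (window-∈-windows k j Y j<Y)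

  length-sensitive : ∀ i → i + k ≤ n → length (map just (window W i k)) ≡ k
  length-sensitive i le = trans (Listₚ.length-map just (window W i k)) (window-length W i k le)

  condI : CondI W k C X
  condI i fits cᵢ occ
    with ∈-map⁻ (map just) (subst (map just (window W i k) ∈_) kmers-output
           (occurs⇒∈-kmers X _ (length-sensitive i fits) (all-just-map-just (window W i k)) occ))
  ... | v , v∈ , same with ∈-plainKmers⁻ v∈
  ... | q , q-fits , c , refl
    with trans (sym c) (trans (C≡S q q-fits)
           (proj₂ valid i q (trans (sym (C≡S i fits)) cᵢ) q-fits (sym (Listₚ.map-injective just-injective same))))
  ... | ()

  minimal : ∀ Y → CondI W k C Y → CondII _≟A_ W k S Y → length X ≤ length Y
  minimal Y condIY condIIY =
    subst (_≤ length Y) (sym length-X) (≤-trans (m≤n+m _ (offset k Y)) (spellLength-kmers-≤ (_≟LM_ _≟A_) m Y))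
    where
    open ≡-Reasoning
    -- by (I) no k-mer of Y is sensitive, so (II) pins down all of them
    all-plain : ∀ w → w ∈ kmers k Y → isPlain w ≡ true
    all-plain w w∈ with isSensitive w in sens
    ... | false = refl
    ... | true with isSensitive⇒ w sens | ∈-filterᵇ⁻ (isKmer k) w∈
    ...   | i , sᵢ , i-fits , refl | w∈windows , isK with ∈-windows⁻ k Y w∈windows
    ...     | j , _ , at-j =
      ⊥-elim (condIY i i-fits (trans (C≡S i i-fits) sᵢ)
        (j , subst (λ x → j + x ≤ length Y) (sym (length-sensitive i i-fits))
                   (window-length⇒bound Y j k (s≤s z≤n) (trans (cong length at-j) (isKmer⇒length k (map just (window W i k)) isK))) ,
             trans (cong (window Y j) (length-sensitive i i-fits)) at-j))
    same-kmers : map (map just) plainKmers ≡ kmers k Y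
    same-kmers = begin
      map (map just) plainKmers              ≡⟨ sym plain-kmers-W ⟩
      filterᵇ isPlain (kmers k (map just W)) ≡⟨ sym (map-window-Iset (map just W)) ⟩
      _                                      ≡⟨ condIIY ⟩
      map (λ j → window Y j k) (Iset _≟A_ W k S Y) ≡⟨ map-window-Iset Y ⟩
      filterᵇ isPlain (kmers k Y)            ≡⟨ filterᵇ-all isPlain (kmers k Y) all-plain ⟩
      kmers k Y                              ∎
    length-X : length X ≡ Spelling.spellLength (_≟LM_ _≟A_) k (kmers k Y)
    length-X = begin
      length X                                                         ≡⟨ length-output ⟩
      Spelling.spellLength (_≟L_ _≟A_) k plainKmers                    ≡⟨ sym (spellLength-map-just _≟A_ k plainKmers) ⟩
      Spelling.spellLength (_≟LM_ _≟A_) k (map (map just) plainKmers)  ≡⟨ cong (Spelling.spellLength (_≟LM_ _≟A_) k) same-kmers ⟩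
      Spelling.spellLength (_≟LM_ _≟A_) k (kmers k Y)                  ∎

  module Frequency (U : List A) (ℓ : length U ≡ k) where

    U′ : List (Maybe A)
    U′ = map just U

    ℓ′ : length U′ ≡ k
    ℓ′ = trans (Listₚ.length-map just U) ℓ

    isU : List (Maybe A) → Bool
    isU w = does (_≟LM_ _≟A_ w U′)

    count : List (List (Maybe A)) → ℕ
    count ws = length (filterᵇ isU ws)

    Freq-kmers : ∀ V → Freq _≟A_ V U′ ≡ count (kmers k V)
    Freq-kmers V = at-length (length U′) ℓ′
      where
      open ≡-Reasoning
      w : ℕ → List (Maybe A)
      w j = window V j k
      fits-if-equal : ∀ j → does (j + k ≤? length V) ∧ isU (w j) ≡ isU (w j)
      fits-if-equal j with _≟LM_ _≟A_ (w j) U′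
      ... | yes e rewrite dec-true (j + k ≤? length V) (window-length⇒bound V j k (s≤s z≤n) (trans (cong length e) ℓ′)) = refl
      ... | no  _ = ∧-zeroʳ _
      last-empty : filterᵇ isU (w (length V) ∷ []) ≡ []
      last-empty = filterᵇ-reject isU {w (length V)} []
        (trans (cong isU w-empty) (dec-false (_≟LM_ _≟A_ [] U′) (λ e → 0≢1+n (trans (cong length e) ℓ′))))
        where
        w-empty : w (length V) ≡ []
        w-empty = trans (cong (take k) (Listₚ.drop-all (length V) V ≤-refl)) (Listₚ.take-[] k)
      isKmer-U : ∀ v → v ∈ windows k V → isU v ≡ true → isKmer k v ≡ true
      isKmer-U v _ e with does-true (_≟LM_ _≟A_ v U′) e
      ... | refl = isKmer-accept k U′ ℓ′ (all-just-map-just U)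
      at-length : ∀ L → L ≡ k →
        length (filterᵇ (λ j → does (j + L ≤? length V) ∧ does (_≟LM_ _≟A_ (window V j L) U′)) (upTo (suc (length V))))
          ≡ count (kmers k V)
      at-length .k refl = begin
        length (filterᵇ (λ j → does (j + k ≤? length V) ∧ isU (w j)) (upTo (suc (length V))))
          ≡⟨ cong length (filterᵇ-cong _ (isU ∘ w) (upTo (suc (length V))) (λ j _ → fits-if-equal j)) ⟩
        length (filterᵇ (isU ∘ w) (upTo (suc (length V))))
          ≡⟨ sym (Listₚ.length-map w (filterᵇ (isU ∘ w) (upTo (suc (length V))))) ⟩
        length (map w (filterᵇ (isU ∘ w) (upTo (suc (length V)))))
          ≡⟨ cong length (map-filterᵇ w isU (upTo (suc (length V)))) ⟩
        count (map w (upTo (suc (length V))))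
          ≡⟨ cong (count ∘ map w) (sym (Listₚ.upTo-∷ʳ (length V))) ⟩
        count (map w (upTo (length V) ∷ʳ length V))
          ≡⟨ cong count (Listₚ.map-++ w (upTo (length V)) (length V ∷ [])) ⟩
        length (filterᵇ isU (map w (upTo (length V)) ++ (w (length V) ∷ [])))
          ≡⟨ cong length (filterᵇ-++ isU (map w (upTo (length V))) (w (length V) ∷ [])) ⟩
        length (filterᵇ isU (map w (upTo (length V))) ++ filterᵇ isU (w (length V) ∷ []))
          ≡⟨ cong (λ z → length (filterᵇ isU (map w (upTo (length V))) ++ z)) last-empty ⟩
        length (filterᵇ isU (map w (upTo (length V))) ++ [])
          ≡⟨ cong length (Listₚ.++-identityʳ (filterᵇ isU (map w (upTo (length V))))) ⟩
        count (map w (upTo (length V)))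
          ≡⟨ cong count (map-window-upTo k V) ⟩
        count (windows k V)
          ≡⟨ cong length (filterᵇ-refine isU (isKmer k) (windows k V) isKmer-U) ⟩
        count (kmers k V) ∎

    count-map-just : ∀ vs → count (map (map just) vs) ≡ length (filterᵇ (λ v → does (_≟L_ _≟A_ v U)) vs)
    count-map-just vs = begin
      length (filterᵇ isU (map (map just) vs))                   ≡⟨ cong length (sym (map-filterᵇ (map just) isU vs)) ⟩
      length (map (map just) (filterᵇ (isU ∘ map just) vs))      ≡⟨ Listₚ.length-map (map just) (filterᵇ (isU ∘ map just) vs) ⟩
      length (filterᵇ (isU ∘ map just) vs)                       ≡⟨ cong length (filterᵇ-cong _ _ vs (λ v _ → does-≡-dec-map-just _≟A_ v U)) ⟩
      length (filterᵇ (λ v → does (_≟L_ _≟A_ v U)) vs)           ∎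
      where open ≡-Reasoning

  condIII : CondIII _≟A_ W k C X
  condIII U ℓ not-sensitive = begin
    Freq _≟A_ X U′                       ≡⟨ Freq-kmers X ⟩
    count (kmers k X)                    ≡⟨ cong count kmers-output ⟩
    count (map (map just) plainKmers)    ≡⟨ count-map-just plainKmers ⟩
    length (filterᵇ isU₀ plainKmers)     ≡⟨ sym W-side ⟩
    count (kmers k (map just W))         ≡⟨ sym (Freq-kmers (map just W)) ⟩
    Freq _≟A_ (map just W) U′            ∎
    where
    open Frequency U ℓ
    open ≡-Reasoning
    isU₀ : List A → Bool
    isU₀ v = does (_≟L_ _≟A_ v U)
    w : ℕ → List A
    w q = window W q k
    plain-if-U : ∀ q → q ∈ positions → isU₀ (w q) ≡ true → not (C q) ≡ true
    plain-if-U q q∈ e with C q in c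
    ... | false = refl
    ... | true  = ⊥-elim (not-sensitive q (∈-positions⇒fits q∈) c (does-true (_≟L_ _≟A_ (w q) U) e))
    W-side : count (kmers k (map just W)) ≡ length (filterᵇ isU₀ plainKmers)
    W-side = begin
      count (kmers k (map just W))                          ≡⟨ cong count (trans kmers-W (Listₚ.map-∘ {g = map just} {f = w} positions)) ⟩
      count (map (map just) (map w positions))              ≡⟨ count-map-just (map w positions) ⟩
      length (filterᵇ isU₀ (map w positions))               ≡⟨ cong length (sym (map-filterᵇ w isU₀ positions)) ⟩
      length (map w (filterᵇ (isU₀ ∘ w) positions))         ≡⟨ cong (length ∘ map w) (filterᵇ-refine _ (not ∘ C) positions plain-if-U) ⟩
      length (map w (filterᵇ (isU₀ ∘ w) (filterᵇ (not ∘ C) positions)))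
                                                            ≡⟨ cong length (map-filterᵇ w isU₀ (filterᵇ (not ∘ C) positions)) ⟩
      length (filterᵇ isU₀ plainKmers)                      ∎

  tfs-correct : CondI W k C X × CondII _≟A_ W k S X × CondIII _≟A_ W k C X × CondIV W k X ×
    (length X ≤ bound n k) × (∀ Y → CondI W k C Y → CondII _≟A_ W k S Y → length X ≤ length Y)
  tfs-correct = condI , condII , condIII , (countHash-output-≤ , spaced⇒hashes-apart spaced-output) , length-output-≤ , minimal

length-interval : ∀ s t → length (interval s t) ≡ t
length-interval s zero = refl
length-interval s (suc t) = cong suc (length-interval (suc s) t)

drop-interval : ∀ s t q → drop q (interval s t) ≡ interval (s + q) (t ∸ q)
drop-interval s t zero = cong (λ r → interval r t) (sym (+-identityʳ s))
drop-interval s zero (suc q) = refl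
drop-interval s (suc t) (suc q) = trans (drop-interval (suc s) t q) (cong (λ r → interval r (t ∸ q)) (sym (+-suc s q)))

-- In W = 0, 1, ..., n - 1 the window at q starts with the letter q, so distinct windows differ.
module Distinct (n : ℕ) where

  W : List ℕ
  W = interval 0 n

  window-head : ∀ q a → q < n → ∃ λ rest → window W q (suc a) ≡ q ∷ rest
  window-head q a q<n with n ∸ q | drop-interval 0 n q | m>n⇒m∸n≢0 q<n
  ... | zero  | _ | ≢0 = ⊥-elim (≢0 refl)
  ... | suc r | e | _  = take a (interval (suc q) r) , cong (take (suc a)) e

  window-injective : ∀ {q q′} a → q < n → q′ < n → window W q (suc a) ≡ window W q′ (suc a) → q ≡ q′
  window-injective a q<n q′<n e with window-head _ a q<n | window-head _ a q′<n
  ... | _ , e₁ | _ , e₂ = Listₚ.∷-injectiveˡ (trans (sym e₁) (trans e e₂))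

  valid : ∀ m (S : ℕ → Bool) → (∀ i → S i ≡ true → i + suc m ≤ n) → ValidS W (suc m) S
  valid m S fits = fits′ , closed
    where
    fits′ : ∀ i → S i ≡ true → i + suc m ≤ length W
    fits′ i sᵢ = subst (i + suc m ≤_) (sym (length-interval 0 n)) (fits i sᵢ)
    start< : ∀ {q} → q + suc m ≤ length W → q < n
    start< {q} le = subst (q <_) (length-interval 0 n) (<-≤-trans (m<m+n q (s≤s z≤n)) le)
    closed : ∀ i j → S i ≡ true → j + suc m ≤ length W → window W j (suc m) ≡ window W i (suc m) → S j ≡ true
    closed i j sᵢ le e rewrite window-injective m (start< le) (start< (fits′ i sᵢ)) e = sᵢ

module _ (n m : ℕ) (k<n : suc m < n) where

  open Distinct n

  k<|W| : suc m < length W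
  k<|W| = subst (suc m <_) (sym (length-interval 0 n)) k<n

  -- every window sensitive: nothing survives
  tight-zero : ∃ λ (W : List ℕ) → ∃ λ (S : ℕ → Bool) →
    length W ≡ n × ValidS W (suc m) S × length (tfs _≟_ W (suc m) (Carray W (suc m) S)) ≡ 0
  tight-zero = W , S , length-interval 0 n , valid m S fits , trans length-output (cong (Spelling.spellLength (_≟L_ _≟_) (suc m)) none)
    where
    S : ℕ → Bool
    S i = does (i + suc m ≤? length W)
    fits : ∀ i → S i ≡ true → i + suc m ≤ n
    fits i e = subst (i + suc m ≤_) (length-interval 0 n) (does-true (i + suc m ≤? length W) e)
    open Correctness _≟_ W m S k<|W| (valid m S fits) hiding (n)
    none : plainKmers ≡ []
    none = nonSensitive-none (suc (length W ∸ k)) 0 λ i _ _ →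
      dec-true ((i ⊓ (length W ∸ k)) + k ≤? length W) (m≤o∸n⇒m+n≤o (i ⊓ (length W ∸ k)) (<⇒≤ k<|W|) (m⊓n≤n i _))

  length-output-C0 : ∀ (S : ℕ → Bool) → Carray W (suc m) S 0 ≡ false →
    length (tfs _≟_ W (suc m) (Carray W (suc m) S)) ≡ suc m + length (Run.run _≟_ W m (Carray W (suc m) S) (length W ∸ suc m) 0 0 [])
  length-output-C0 S c₀ = begin
    length (tfs _≟_ W (suc m) C)                   ≡⟨ cong length (output-C0 c₀ (<-trans (s≤s z≤n) k<|W|)) ⟩
    length (map just (window W 0 (suc m)) ++ R)    ≡⟨ Listₚ.length-++ (map just (window W 0 (suc m))) ⟩
    length (map just (window W 0 (suc m))) + length R
      ≡⟨ cong (_+ length R) (trans (Listₚ.length-map just (window W 0 (suc m))) (window-length W 0 (suc m) (<⇒≤ k<|W|))) ⟩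
    suc m + length R                               ∎
    where
    open ≡-Reasoning
    C = Carray W (suc m) S
    open Run _≟_ W m C hiding (n)
    R = run (length W ∸ suc m) 0 0 []

-- no window sensitive and k = 1: every letter of W is copied
tight-bound-1 : ∀ n → 1 < n → ∃ λ (W : List ℕ) → ∃ λ (S : ℕ → Bool) →
  length W ≡ n × ValidS W 1 S × length (tfs _≟_ W 1 (Carray W 1 S)) ≡ bound n 1
tight-bound-1 n 1<n = W , S , length-interval 0 n , valid 0 S (λ _ ()) , (begin
    length (tfs _≟_ W 1 (Carray W 1 S))                ≡⟨ length-output-C0 n 0 1<n S refl ⟩
    1 + length (run (length W ∸ 1) 0 0 [])             ≡⟨ cong suc (letters (length W ∸ 1) 0 0 (≤-reflexive (m+[n∸m]≡n (<⇒≤ (k<|W| n 0 1<n))))) ⟩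
    1 + (length W ∸ 1)                                 ≡⟨ cong suc (sym (maxLength-k≡1 (length W ∸ 1))) ⟩
    1 + maxLength false (length W ∸ 1)                 ≡⟨ maxLength≡bound ⟩
    bound (length W) 1                                 ≡⟨ cong (λ r → bound r 1) (length-interval 0 n) ⟩
    bound n 1                                          ∎)
  where
  open ≡-Reasoning
  open Distinct n
  S : ℕ → Bool
  S _ = false
  open Run _≟_ W 0 (Carray W 1 S) hiding (n)
  letters : ∀ t p f → p + k + t ≤ length W → length (run t p f []) ≡ t
  letters zero p f _ = refl
  letters (suc t) p f le = trans (cong length (run-00 {t} {p} {f} refl refl))
    (trans (Listₚ.length-++ (letterAt p)) (cong₂ _+_ (length-letterAt p (letter-fits {p} {t} le)) (letters t (suc p) f (remaining {p} {t} le))))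
  maxLength-k≡1 : ∀ t → maxLength false t ≡ t
  maxLength-k≡1 zero = refl
  maxLength-k≡1 (suc zero) = refl
  maxLength-k≡1 (suc (suc t)) = cong (suc ∘ suc) (maxLength-k≡1 t)

odd : ℕ → Bool
odd zero    = false
odd (suc n) = not (odd n)

-- k ≥ 2 and C alternates 0, 1, 0, 1, ...: every other window restarts after a #
tight-bound-2 : ∀ n m → suc (suc m) < n → ∃ λ (W : List ℕ) → ∃ λ (S : ℕ → Bool) →
  length W ≡ n × ValidS W (suc (suc m)) S × length (tfs _≟_ W (suc (suc m)) (Carray W (suc (suc m)) S)) ≡ bound n (suc (suc m))
tight-bound-2 n m k<n = W , S , length-interval 0 n , valid (suc m) S fits , (begin
    length (tfs _≟_ W k C)                      ≡⟨ length-output-C0 n (suc m) k<n S refl ⟩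
    k + length (run last 0 0 [])                ≡⟨ cong (k +_) (alternating last 0 0 refl refl refl) ⟩
    k + maxLength false last                    ≡⟨ maxLength≡bound ⟩
    bound (length W) k                          ≡⟨ cong (λ r → bound r k) (length-interval 0 n) ⟩
    bound n k                                   ∎)
  where
  open ≡-Reasoning
  open Distinct n
  last : ℕ
  last = length W ∸ suc (suc m)
  S : ℕ → Bool
  S i = odd i ∧ does (suc i ≤? last)
  C = Carray W (suc (suc m)) S
  open Run _≟_ W (suc m) C hiding (n)
  k≤W : k ≤ length W
  k≤W = <⇒≤ (k<|W| n (suc m) k<n)
  fits : ∀ i → S i ≡ true → i + k ≤ n
  fits i e = subst (i + k ≤_) (length-interval 0 n)
               (m≤o∸n⇒m+n≤o i k≤W (≤-trans (n≤1+n i) (does-true (suc i ≤? last) (∧-conicalʳ (odd i) _ e))))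
  C≡S : ∀ q → q ≤ last → C q ≡ S q
  C≡S q le = cong S (m≤n⇒m⊓n≡m le)
  window-fits : ∀ {q} → q ≤ last → q + k ≤ length W
  window-fits {q} = m≤o∸n⇒m+n≤o q k≤W
  alternating : ∀ t p f → odd p ≡ false → p + t ≡ last → C p ≡ false → length (run t p f []) ≡ maxLength false t
  alternating zero p f _ _ _ = refl
  alternating (suc zero) p f _ p+1≡ c₀ =
    trans (cong length (run-00 {0} {p} {f} c₀ c₁)) (trans (Listₚ.length-++ (letterAt p)) (cong (_+ 0) (length-letterAt p p+k<W)))
    where
    p+1≡last : suc p ≡ last
    p+1≡last = trans (sym (+-comm p 1)) p+1≡
    c₁ : C (suc p) ≡ false
    c₁ = trans (C≡S (suc p) (≤-reflexive p+1≡last))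
               (trans (cong (odd (suc p) ∧_) (dec-false (suc (suc p) ≤? last) (<-irrefl p+1≡last))) (∧-zeroʳ _))
    p+k<W : p + k < length W
    p+k<W = subst (_≤ length W) (cong (_+ k) (sym p+1≡last)) (window-fits ≤-refl)
  alternating (suc (suc t)) p f even p+t≡ c₀ = begin
    length (run (suc (suc t)) p f [])                       ≡⟨ cong length (run-01 {suc t} {p} {f} c₀ c₁) ⟩
    length (run (suc t) (suc p) (suc p) [])                 ≡⟨ cong length (run-10 {t} {suc p} {suc p} c₁ c₂) ⟩
    length (rejoin (suc p) (suc p) ++ R)                    ≡⟨ Listₚ.length-++ (rejoin (suc p) (suc p)) ⟩
    length (rejoin (suc p) (suc p)) + length R              ≡⟨ cong₂ _+_ length-rejoin
                                                                 (alternating t (suc (suc p)) (suc p) (trans (not-involutive (odd p)) even) p+2+t≡ c₂) ⟩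
    suc k + maxLength false t                               ∎
    where
    R = run t (suc (suc p)) (suc p) []
    p+2+t≡ : suc (suc p) + t ≡ last
    p+2+t≡ = trans (cong suc (sym (+-suc p t))) (trans (sym (+-suc p (suc t))) p+t≡)
    p+2≤ : suc (suc p) ≤ last
    p+2≤ = subst (suc (suc p) ≤_) p+2+t≡ (m≤m+n (suc (suc p)) t)
    c₁ : C (suc p) ≡ true
    c₁ = trans (C≡S (suc p) (≤-trans (n≤1+n _) p+2≤))
               (trans (cong (odd (suc p) ∧_) (dec-true (suc (suc p) ≤? last) p+2≤)) (trans (∧-identityʳ (odd (suc p))) (cong not even)))
    c₂ : C (suc (suc p)) ≡ false
    c₂ = trans (C≡S (suc (suc p)) p+2≤) (cong (_∧ does (suc (suc (suc p)) ≤? last)) (trans (not-involutive (odd p)) even))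
    p+2<n : suc (suc p) < n
    p+2<n = subst (suc (suc p) <_) (length-interval 0 n) (<-≤-trans (m<m+n (suc (suc p)) (s≤s z≤n)) (window-fits p+2≤))
    length-rejoin : length (rejoin (suc p) (suc p)) ≡ suc k
    length-rejoin with continues (suc p) (suc p) in same
    ... | false = length-restart (suc p) (window-fits p+2≤)
    ... | true with window-injective m p+2<n (<-trans (n<1+n _) p+2<n)
                      (does-true (_≟L_ _≟_ (window W (suc (suc p)) (suc m)) (window W (suc p) (suc m))) same)
    ...   | ()

lemma1 :
    (∀ {A : Set} (_≟A_ : DecidableEquality A) (W : List A) (k : ℕ) (S : ℕ → Bool) →
      0 < k → k < length W → ValidS W k S →
      CondI W k (Carray W k S) (tfs _≟A_ W k (Carray W k S)) ×
      CondII _≟A_ W k S (tfs _≟A_ W k (Carray W k S)) ×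
      CondIII _≟A_ W k (Carray W k S) (tfs _≟A_ W k (Carray W k S)) ×
      CondIV W k (tfs _≟A_ W k (Carray W k S)) ×
      (length (tfs _≟A_ W k (Carray W k S)) ≤ bound (length W) k) ×
      (∀ (Y : List (Maybe A)) → CondI W k (Carray W k S) Y → CondII _≟A_ W k S Y →
        length (tfs _≟A_ W k (Carray W k S)) ≤ length Y)) ×
    (∀ (n k : ℕ) → 0 < k → k < n →
      (∃ λ (W : List ℕ) → ∃ λ (S : ℕ → Bool) →
        (length W ≡ n) × ValidS W k S × (length (tfs _≟_ W k (Carray W k S)) ≡ 0)) ×
      (∃ λ (W : List ℕ) → ∃ λ (S : ℕ → Bool) →
        (length W ≡ n) × ValidS W k S × (length (tfs _≟_ W k (Carray W k S)) ≡ bound n k)))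
lemma1 =
  (λ { _≟A_ W zero S () k<n valid
     ; _≟A_ W (suc m) S _ k<n valid → Correctness.tfs-correct _≟A_ W m S k<n valid })
  , λ { n zero () k<n
      ; n (suc zero) _ 1<n → tight-zero n 0 1<n , tight-bound-1 n 1<n
      ; n (suc (suc m)) _ k<n → tight-zero n (suc m) k<n , tight-bound-2 n m k<n }
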